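{- Let $\mathbf{CDA}$ be the operad of commutative associative (not necessarily unitary) differential algebras, i.e. the operad generated by $\partial\in\mathbf{CDA}(1)$ and $m\in\mathbf{CDA}(2)$ subject to the relations $$m^{(12)}=m,\qquad m\circ_1 m=m\circ_2 m,\qquad \partial\circ m=m\circ_1\partial+m\circ_2\partial.$$ Let $\mathbf{NMI}$ be the operad of noncommutative multi-indices described below. Then there exists a unique operad isomorphism $\theta:\mathbf{CDA}\to\mathbf{NMI}$ sending $\partial$ to $X_1$ and $m$ to $X_0X_0$.
   Context: $\mathbb{K}$ is a field of characteristic $0$. Let $(X_i)_{i\in\mathbb{N}}$ be non-commuting indeterminates. For $n\geq1$, $\mathbf{NMI}(n)$ is the vector space with basis the words $X_{i_1}\cdots X_{i_n}$ ($i_1,\dots,i_n\in\mathbb{N}$) of length $n$, so that $\bigoplus_{n\geq1}\mathbf{NMI}(n)=\mathbb{K}\langle X_i\mid i\in\mathbb{N}\rangle_+$ (non-unitary free associative algebra under concatenation). Let $D$ be the derivation of this algebra with $D(X_i)=X_{i+1}$ for all $i$. The operad structure on $\mathbf{NMI}$ is: composition $X_{i_1}\cdots X_{i_n}\circ(P_1,\dots,P_n)=D^{i_1}(P_1)\cdots D^{i_n}(P_n)$ (extended multilinearly), unit $X_0\in\mathbf{NMI}(1)$, and right $\mathfrak{S}_n$-action $(X_{i_1}\cdots X_{i_n})^\sigma=X_{i_{\sigma(1)}}\cdots X_{i_{\sigma(n)}}$. Partial compositions are $p\circ_i q=p\circ(I,\dots,I,q,I,\dots,I)$ with $q$ in position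 $i$ and $I$ the unit. -}

module Defs where

open import Level using (Level; _⊔_)
open import Data.Nat as ℕ using (ℕ; zero; suc; _+_)
open import Data.Nat.Properties using (+-identityʳ; +-suc; +-assoc; +-comm)
open import Data.Fin as Fin using (Fin; zero; suc; cast)
open import Data.Fin.Permutation using (Permutation′; _⟨$⟩ʳ_)
open import Data.Vec using (Vec; _∷_; []; tabulate; lookup)
open import Data.Vec.Properties using (≡-dec)
open import Data.List as List using (List; _∷_; []; _++_; concatMap)
open import Data.Product using (_×_; _,_; ∃)
open import Data.Sum using (_⊎_; inj₁; inj₂)
open import Data.Sum using () renaming (map to map⊎)
open import Function using (id)
open import Relation.Nullary using (¬_; yes; no)
open import Relation.Binary.PropositionalEquality using (_≡_; subst; trans; cong)
import Relation.Binary.PropositionalEquality as Eq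
import Data.Sum
open import Algebra.Bundles using (CommutativeRing)

record Field (c ℓ : Level) : Set (Level.suc (c ⊔ ℓ)) where
  field
    commutativeRing : CommutativeRing c ℓ
  open CommutativeRing commutativeRing public
  field
    1≉0     : ¬ (1# ≈ 0#)
    inverse : ∀ x → ¬ (x ≈ 0#) → ∃ λ y → (x * y) ≈ 1#

_×1 : ∀ {c ℓ} {F : Field c ℓ} → ℕ → Field.Carrier F
_×1 {F = F} zero    = Field.0# F
_×1 {F = F} (suc n) = Field._+_ F (Field.1# F) (_×1 {F = F} n)

CharacteristicZero : ∀ {c ℓ} → Field c ℓ → Set ℓ
CharacteristicZero F = ∀ n → Field._≈_ F (_×1 {F = F} n) (Field.0# F) → n ≡ zero

-- Arity convention: throughout, index k stands for arity (suc k), so all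
-- arities are ≥ 1.  Inputs of an element of arity (suc k) are Fin (suc k)
-- (0-based: input 0 is the paper's input 1).

-- Source of the inputs of a partial composite p ∘ᵢ q, p of arity suc a,
-- q of arity suc b.  Input j of the composite (arity suc (a + b)) is either
-- input k (≠ i) of p  (inj₁ k)  or input l of q  (inj₂ l); the inputs of q
-- occupy positions i, …, i + b.

src₀ : ∀ a b → Fin (suc (a + b)) → Fin (suc a) ⊎ Fin (suc b)
src₀ a zero    zero    = inj₂ zero
src₀ a zero    (suc j) = inj₁ (suc (cast (+-identityʳ a) j))
src₀ a (suc b) zero    = inj₂ zero
src₀ a (suc b) (suc j) = map⊎ id suc (src₀ a b (cast (+-suc a b) j))

src : ∀ {a b} → Fin (suc a) → Fin (suc (a + b)) → Fin (suc a) ⊎ Fin (suc b)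
src {a}     {b} zero    j       = src₀ a b j
src {suc a} {b} (suc i) zero    = inj₁ zero
src {suc a} {b} (suc i) (suc j) = map⊎ suc id (src {a} {b} i j)

module Over {c ℓ : Level} (F : Field c ℓ) where

  open Field F using (Carrier; 0#; 1#)
    renaming (_≈_ to _≈F_; _+_ to _+F_; _*_ to _*F_)

  infixl 6 _⊕_
  infixr 7 _·_
  infix  4 _≈_

  -- Built as the term model:
  -- formal expressions in the operad operations (linear structure, unit,
  -- partial compositions, right symmetric-group action) modulo the
  -- smallest congruence containing the vector-space axioms, the linearity
  -- of compositions and action, the operad axioms and the relations.

  data Term : ℕ → Set c where
    ∂ⁱ    : Term 0
    mⁱ    : Term 1
    unit  : Term 0
    _∘[_]_ : ∀ {a b} → Term a → Fin (suc a) → Term b → Term (a + b)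
    act   : ∀ {a} → Term a → Permutation′ (suc a) → Term a
    𝟘     : ∀ {a} → Term a
    _⊕_   : ∀ {a} → Term a → Term a → Term a
    _·_   : ∀ {a} → Carrier → Term a → Term a

  data _≈_ : ∀ {a} → Term a → Term a → Set (c ⊔ ℓ) where
    ≈-refl  : ∀ {a} {s : Term a} → s ≈ s
    ≈-sym   : ∀ {a} {s t : Term a} → s ≈ t → t ≈ s
    ≈-trans : ∀ {a} {s t u : Term a} → s ≈ t → t ≈ u → s ≈ u
    ∘-cong  : ∀ {a b} {s s′ : Term a} {t t′ : Term b} (i : Fin (suc a)) →
              s ≈ s′ → t ≈ t′ → s ∘[ i ] t ≈ s′ ∘[ i ] t′
    act-cong : ∀ {a} {s t : Term a} (σ : Permutation′ (suc a)) →
              s ≈ t → act s σ ≈ act t σ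
    ⊕-cong  : ∀ {a} {s s′ t t′ : Term a} → s ≈ s′ → t ≈ t′ → s ⊕ t ≈ s′ ⊕ t′
    ·-cong  : ∀ {a} {x y : Carrier} {s t : Term a} → x ≈F y → s ≈ t → x · s ≈ y · t
    ⊕-assoc : ∀ {a} (s t u : Term a) → (s ⊕ t) ⊕ u ≈ s ⊕ (t ⊕ u)
    ⊕-comm  : ∀ {a} (s t : Term a) → s ⊕ t ≈ t ⊕ s
    ⊕-idˡ   : ∀ {a} (s : Term a) → 𝟘 ⊕ s ≈ s
    ·-zero  : ∀ {a} (s : Term a) → 0# · s ≈ 𝟘
    ·-one   : ∀ {a} (s : Term a) → 1# · s ≈ s
    ·-assoc : ∀ {a} x y (s : Term a) → (x *F y) · s ≈ x · (y · s)
    ·-distʳ : ∀ {a} x y (s : Term a) → (x +F y) · s ≈ x · s ⊕ y · s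
    ·-distˡ : ∀ {a} x (s t : Term a) → x · (s ⊕ t) ≈ x · s ⊕ x · t
    ∘-⊕ˡ : ∀ {a b} (s t : Term a) i (u : Term b) → (s ⊕ t) ∘[ i ] u ≈ s ∘[ i ] u ⊕ t ∘[ i ] u
    ∘-⊕ʳ : ∀ {a b} (s : Term a) i (t u : Term b) → s ∘[ i ] (t ⊕ u) ≈ s ∘[ i ] t ⊕ s ∘[ i ] u
    ∘-·ˡ : ∀ {a b} x (s : Term a) i (u : Term b) → (x · s) ∘[ i ] u ≈ x · (s ∘[ i ] u)
    ∘-·ʳ : ∀ {a b} x (s : Term a) i (u : Term b) → s ∘[ i ] (x · u) ≈ x · (s ∘[ i ] u)
    act-⊕ : ∀ {a} (s t : Term a) σ → act (s ⊕ t) σ ≈ act s σ ⊕ act t σ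
    act-· : ∀ {a} x (s : Term a) σ → act (x · s) σ ≈ x · act s σ
    act-id : ∀ {a} (s : Term a) (ι : Permutation′ (suc a)) →
             (∀ j → ι ⟨$⟩ʳ j ≡ j) → act s ι ≈ s
    act-∘  : ∀ {a} (s : Term a) (σ τ ρ : Permutation′ (suc a)) →
             (∀ j → ρ ⟨$⟩ʳ j ≡ σ ⟨$⟩ʳ (τ ⟨$⟩ʳ j)) → act (act s σ) τ ≈ act s ρ
    unitˡ : ∀ {b} (s : Term b) → unit ∘[ zero ] s ≈ s
    unitʳ : ∀ {a} (s : Term a) i → subst Term (+-identityʳ a) (s ∘[ i ] unit) ≈ s
    -- sequential associativity: j is an input of p ∘ᵢ q coming from input k of q
    seq : ∀ {a b d} (p : Term a) (q : Term b) (r : Term d) i j k →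
          src {a} {b} i j ≡ inj₂ k →
          subst Term (+-assoc a b d) ((p ∘[ i ] q) ∘[ j ] r) ≈ p ∘[ i ] (q ∘[ k ] r)
    -- parallel associativity: j is an input of p ∘ᵢ q coming from input k of p,
    -- and j′ is the input of p ∘ₖ r coming from input i of p
    par : ∀ {a b d} (p : Term a) (q : Term b) (r : Term d) i j k j′ →
          src {a} {b} i j ≡ inj₁ k → src {a} {d} k j′ ≡ inj₁ i →
          subst Term (trans (+-assoc a b d) (trans (cong (a +_) (+-comm b d)) (Eq.sym (+-assoc a d b))))
            ((p ∘[ i ] q) ∘[ j ] r) ≈ (p ∘[ k ] r) ∘[ j′ ] q
    equivˡ : ∀ {a b} (p : Term a) (q : Term b) i (σ : Permutation′ (suc a))
             (σ′ : Permutation′ (suc (a + b))) →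
             (∀ j → src {a} {b} (σ ⟨$⟩ʳ i) (σ′ ⟨$⟩ʳ j) ≡ map⊎ (σ ⟨$⟩ʳ_) id (src {a} {b} i j)) →
             act p σ ∘[ i ] q ≈ act (p ∘[ σ ⟨$⟩ʳ i ] q) σ′
    equivʳ : ∀ {a b} (p : Term a) (q : Term b) i (τ : Permutation′ (suc b))
             (τ′ : Permutation′ (suc (a + b))) →
             (∀ j → src {a} {b} i (τ′ ⟨$⟩ʳ j) ≡ map⊎ id (τ ⟨$⟩ʳ_) (src {a} {b} i j)) →
             p ∘[ i ] act q τ ≈ act (p ∘[ i ] q) τ′
    rel-comm : (τ : Permutation′ 2) → τ ⟨$⟩ʳ zero ≡ suc zero → τ ⟨$⟩ʳ suc zero ≡ zero →
               act mⁱ τ ≈ mⁱ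
    rel-assoc : mⁱ ∘[ zero ] mⁱ ≈ mⁱ ∘[ suc zero ] mⁱ
    rel-leibniz : ∂ⁱ ∘[ zero ] mⁱ ≈ mⁱ ∘[ zero ] ∂ⁱ ⊕ mⁱ ∘[ suc zero ] ∂ⁱ

  -- NMI: NMI(suc a) = vector space with basis the words of length suc a in
  -- the letters X_i (i ∈ ℕ); a word is a Vec ℕ (suc a) of indices.

  Word : ℕ → Set
  Word a = Vec ℕ (suc a)

  NMI : ℕ → Set c
  NMI a = List (Carrier × Word a)

  coeff : ∀ {a} → NMI a → Word a → Carrier
  coeff []             w = 0#
  coeff ((x , u) ∷ xs) w with ≡-dec ℕ._≟_ u w
  ... | yes _ = x +F coeff xs w
  ... | no  _ = coeff xs w

  infix 4 _≈ᴺ_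
  _≈ᴺ_ : ∀ {a} → NMI a → NMI a → Set ℓ
  P ≈ᴺ Q = ∀ w → coeff P w ≈F coeff Q w

  0ᴺ : ∀ {a} → NMI a
  0ᴺ = []

  _+ᴺ_ : ∀ {a} → NMI a → NMI a → NMI a
  _+ᴺ_ = _++_

  _·ᴺ_ : ∀ {a} → Carrier → NMI a → NMI a
  x ·ᴺ P = List.map (λ { (y , w) → (x *F y , w) }) P

  X₁ : NMI 0
  X₁ = (1# , 1 ∷ []) ∷ []

  X₀X₀ : NMI 1
  X₀X₀ = (1# , 0 ∷ 0 ∷ []) ∷ []

  Iᴺ : NMI 0
  Iᴺ = (1# , 0 ∷ []) ∷ []

  incrAt : ∀ {n} → Fin n → Vec ℕ n → Vec ℕ n
  incrAt zero    (x ∷ xs) = suc x ∷ xs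
  incrAt (suc k) (x ∷ xs) = x ∷ incrAt k xs

  Dword : ∀ {a} → Word a → List (Word a)
  Dword {a} w = List.map (λ k → incrAt k w) (List.allFin (suc a))

  D : ∀ {a} → NMI a → NMI a
  D = concatMap (λ { (x , w) → List.map (λ v → (x , v)) (Dword w) })

  Dⁿ : ∀ {a} → ℕ → NMI a → NMI a
  Dⁿ zero    P = P
  Dⁿ (suc n) P = D (Dⁿ n P)

  splice : ∀ {a b} → Word a → Fin (suc a) → Word b → Word (a + b)
  splice {a} {b} w i v = tabulate λ j → [ lookup w , lookup v ] (src {a} {b} i j)
    where open Data.Sum using ([_,_])

  -- partial composition: w ∘ᵢ Q = (prefix of w) D^{w_i}(Q) (suffix of w)
  _∘ᴺ[_]_ : ∀ {a b} → NMI a → Fin (suc a) → NMI b → NMI (a + b)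
  P ∘ᴺ[ i ] Q =
    concatMap (λ { (x , w) →
      List.map (λ { (y , v) → (x *F y , splice w i v) }) (Dⁿ (lookup w i) Q) }) P

  actᴺ : ∀ {a} → NMI a → Permutation′ (suc a) → NMI a
  actᴺ P σ = List.map (λ { (x , w) → (x , tabulate λ k → lookup w (σ ⟨$⟩ʳ k)) }) P

  record IsOperadMorphism (θ : ∀ {a} → Term a → NMI a) : Set (c ⊔ ℓ) where
    field
      resp   : ∀ {a} {s t : Term a} → s ≈ t → θ s ≈ᴺ θ t
      hom-⊕  : ∀ {a} (s t : Term a) → θ (s ⊕ t) ≈ᴺ θ s +ᴺ θ t
      hom-·  : ∀ {a} x (s : Term a) → θ (x · s) ≈ᴺ x ·ᴺ θ s
      hom-unit : θ unit ≈ᴺ Iᴺ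
      hom-∘  : ∀ {a b} (s : Term a) i (t : Term b) → θ (s ∘[ i ] t) ≈ᴺ θ s ∘ᴺ[ i ] θ t
      hom-act : ∀ {a} (s : Term a) σ → θ (act s σ) ≈ᴺ actᴺ (θ s) σ

  record IsOperadIsomorphism (θ : ∀ {a} → Term a → NMI a) : Set (c ⊔ ℓ) where
    field
      isMorphism : IsOperadMorphism θ
      injective  : ∀ {a} {s t : Term a} → θ s ≈ᴺ θ t → s ≈ t
      surjective : ∀ {a} (P : NMI a) → ∃ λ (s : Term a) → θ s ≈ᴺ P

  SendsGenerators : (∀ {a} → Term a → NMI a) → Set ℓ
  SendsGenerators θ = (θ ∂ⁱ ≈ᴺ X₁) × (θ mⁱ ≈ᴺ X₀X₀)

module Submission where

-- For a word w = n₁ ⋯ n_k the CDA element ∂^{n₁}x₁ · ∂^{n₂}x₂ ⋯ ∂^{n_k}x_k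
-- ("monomial w") is sent by the structural interpretation θ to the word X_{n₁} ⋯ X_{n_k},
-- and ψ extends w ↦ monomial w linearly.  Checking that θ respects the defining congruence
-- of CDA amounts to the operad axioms in NMI, the key one being that D commutes with
-- composition.  Conversely, the Leibniz, associativity and commutativity relations show
-- that monomials are stable up to ≈ under ∂ ∘ −, partial composition and the action of
-- the symmetric groups, which gives ψ (θ s) ≈ s; and θ (ψ P) ≋ P by direct computation.
-- Uniqueness holds because an operad morphism is determined by its values on ∂ and m.

open import Level using (Level; _⊔_)
open import Data.Nat as ℕ using (ℕ; zero; suc; _+_; _<_; _≤_; z≤n; s≤s)
import Data.Nat.Properties as ℕₚ
open import Data.Nat.Properties using (+-suc; +-identityʳ; +-comm)
open import Data.Fin as Fin using (Fin; zero; suc; toℕ; cast)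
import Data.Fin.Properties as Finₚ
open import Data.Fin.Properties using (toℕ-cast)
import Data.Fin.Permutation as Perm
open import Data.Fin.Permutation using (Permutation′; _⟨$⟩ʳ_; _⟨$⟩ˡ_; inverseˡ)
open import Data.Vec as Vec using (Vec; []; _∷_; tabulate; lookup; toList)
import Data.Vec.Properties as Vecₚ
open import Data.Vec.Properties using (tabulate-cong; tabulate∘lookup; ≡-dec)
open import Data.List as List using (List; []; _∷_; _++_; length; concatMap)
import Data.List.Properties as Listₚ
import Data.Sum.Properties as Sumₚ
open import Data.Sum using (_⊎_; inj₁; inj₂; [_,_]; [_,_]′) renaming (map to map⊎)
open import Data.Product using (Σ; _×_; _,_; proj₁; proj₂)
open import Function using (id; _∘_)
open import Data.Empty using (⊥-elim)
open import Relation.Nullary using (¬_; yes; no)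
open import Relation.Binary.Bundles using (Setoid)
open import Relation.Binary.Definitions using (DecidableEquality)
open import Relation.Binary.PropositionalEquality as ≡ using (_≡_; refl; cong; sym; trans)
open import Algebra.Bundles using (CommutativeMonoid)
import Algebra.Properties.CommutativeMonoid.Sum as SumProperties
import Algebra.Properties.Ring as RingProperties
open import Relation.Binary.PropositionalEquality.Properties using (subst-sym-subst)
open import Defs

record LinearSpace {c ℓ} (F : Field c ℓ) (v e : Level) : Set (c ⊔ ℓ ⊔ Level.suc (v ⊔ e)) where
  open Field F using (Carrier; 0#; 1#) renaming (_≈_ to _≈F_; _+_ to _+F_; _*_ to _*F_)
  infixl 6 _+V_
  infixr 7 _·V_
  infix 4 _≈V_
  field
    V : Set v
    _≈V_ : V → V → Set e
    0V : V
    _+V_ : V → V → V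
    _·V_ : Carrier → V → V
    reflV : ∀ {s} → s ≈V s
    symV : ∀ {s t} → s ≈V t → t ≈V s
    transV : ∀ {s t u} → s ≈V t → t ≈V u → s ≈V u
    +V-cong : ∀ {s s′ t t′} → s ≈V s′ → t ≈V t′ → s +V t ≈V s′ +V t′
    ·V-cong : ∀ {x y s t} → x ≈F y → s ≈V t → x ·V s ≈V y ·V t
    +V-assoc : ∀ s t u → (s +V t) +V u ≈V s +V (t +V u)
    +V-comm : ∀ s t → s +V t ≈V t +V s
    +V-idˡ : ∀ s → 0V +V s ≈V s
    ·V-zero : ∀ s → 0# ·V s ≈V 0V
    ·V-one : ∀ s → 1# ·V s ≈V s
    ·V-assoc : ∀ x y s → (x *F y) ·V s ≈V x ·V (y ·V s)
    ·V-distʳ : ∀ x y s → (x +F y) ·V s ≈V x ·V s +V y ·V s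
    ·V-distˡ : ∀ x s t → x ·V (s +V t) ≈V x ·V s +V x ·V t

module LinearSpaceProperties {c ℓ v e} {F : Field c ℓ} (S : LinearSpace F v e) where
  open LinearSpace S
  open Field F using (0#; 1#; -_; zeroʳ; -‿inverseˡ) renaming (_+_ to _+F_; _*_ to _*F_)

  ≈V-setoid : Setoid v e
  ≈V-setoid = record { Carrier = V ; _≈_ = _≈V_ ; isEquivalence = record { refl = reflV ; sym = symV ; trans = transV } }

  open import Relation.Binary.Reasoning.Setoid ≈V-setoid

  +V-idʳ : ∀ s → s +V 0V ≈V s
  +V-idʳ s = transV (+V-comm s 0V) (+V-idˡ s)

  ·V-zeroʳ : ∀ x → x ·V 0V ≈V 0V
  ·V-zeroʳ x = begin
    x ·V 0V          ≈⟨ ·V-cong (Field.refl F) (symV (·V-zero 0V)) ⟩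
    x ·V (0# ·V 0V)  ≈⟨ symV (·V-assoc x 0# 0V) ⟩
    (x *F 0#) ·V 0V  ≈⟨ ·V-cong (zeroʳ x) reflV ⟩
    0# ·V 0V         ≈⟨ ·V-zero 0V ⟩
    0V               ∎

  +V-interchange : ∀ a b c d → (a +V b) +V (c +V d) ≈V (a +V c) +V (b +V d)
  +V-interchange a b c d = begin
    (a +V b) +V (c +V d)  ≈⟨ +V-assoc a b (c +V d) ⟩
    a +V (b +V (c +V d))  ≈⟨ +V-cong reflV (symV (+V-assoc b c d)) ⟩
    a +V ((b +V c) +V d)  ≈⟨ +V-cong reflV (+V-cong (+V-comm b c) reflV) ⟩
    a +V ((c +V b) +V d)  ≈⟨ +V-cong reflV (+V-assoc c b d) ⟩
    a +V (c +V (b +V d))  ≈⟨ symV (+V-assoc a c (b +V d)) ⟩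
    (a +V c) +V (b +V d)  ∎

  ≈V-from-difference : ∀ s t → s +V (- 1#) ·V t ≈V 0V → s ≈V t
  ≈V-from-difference s t h = begin
    s                              ≈⟨ symV (+V-idʳ s) ⟩
    s +V 0V                        ≈⟨ +V-cong reflV (symV (·V-zero t)) ⟩
    s +V 0# ·V t                   ≈⟨ +V-cong reflV (·V-cong (Field.sym F (-‿inverseˡ 1#)) reflV) ⟩
    s +V ((- 1#) +F 1#) ·V t       ≈⟨ +V-cong reflV (·V-distʳ (- 1#) 1# t) ⟩
    s +V ((- 1#) ·V t +V 1# ·V t)  ≈⟨ symV (+V-assoc _ _ _) ⟩
    (s +V (- 1#) ·V t) +V 1# ·V t  ≈⟨ +V-cong h (·V-one t) ⟩
    0V +V t                        ≈⟨ +V-idˡ t ⟩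
    t                              ∎

module FormalSum {c ℓ} (F : Field c ℓ) {W : Set} (_≟W_ : DecidableEquality W) where
  open Field F using (Carrier; 0#; 1#; -_) renaming (_≈_ to _≈F_; _+_ to _+F_; _*_ to _*F_)
  private module 𝔽 = Field F

  Combination : Set c
  Combination = List (Carrier × W)

  coefficient : Combination → W → Carrier
  coefficient [] w = 0#
  coefficient ((x , u) ∷ P) w with u ≟W w
  ... | yes _ = x +F coefficient P w
  ... | no  _ = coefficient P w

  infix 4 _≈ᶜ_ _≈ᶠ_
  _≈ᶜ_ : Combination → Combination → Set ℓ
  P ≈ᶜ Q = ∀ w → coefficient P w ≈F coefficient Q w

  -- A record, unlike the bare function type _≈ᶜ_, lets Agda infer P and Q from P ≈ᶠ Q.
  record _≈ᶠ_ (P Q : Combination) : Set ℓ where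
    constructor mk≈ᶠ
    field un≈ᶠ : P ≈ᶜ Q
  open _≈ᶠ_ public

  _·ᶠ_ : Carrier → Combination → Combination
  x ·ᶠ P = List.map (λ p → (x *F proj₁ p , proj₂ p)) P

  coefficient-++ : ∀ P Q w → coefficient (P ++ Q) w ≈F coefficient P w +F coefficient Q w
  coefficient-++ [] Q w = 𝔽.sym (𝔽.+-identityˡ _)
  coefficient-++ ((x , u) ∷ P) Q w with u ≟W w
  ... | yes _ = 𝔽.trans (𝔽.+-cong 𝔽.refl (coefficient-++ P Q w)) (𝔽.sym (𝔽.+-assoc _ _ _))
  ... | no  _ = coefficient-++ P Q w

  coefficient-· : ∀ x P w → coefficient (x ·ᶠ P) w ≈F x *F coefficient P w
  coefficient-· x [] w = 𝔽.sym (𝔽.zeroʳ x)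
  coefficient-· x ((y , u) ∷ P) w with u ≟W w
  ... | yes _ = 𝔽.trans (𝔽.+-cong 𝔽.refl (coefficient-· x P w)) (𝔽.sym (𝔽.distribˡ x y _))
  ... | no  _ = coefficient-· x P w

  coefficient-∷-same : ∀ x w R → coefficient ((x , w) ∷ R) w ≈F x +F coefficient R w
  coefficient-∷-same x w R with w ≟W w
  ... | yes _ = 𝔽.refl
  ... | no ¬p = ⊥-elim (¬p ≡.refl)

  coefficient-∷-other : ∀ x u w R → ¬ u ≡ w → coefficient ((x , u) ∷ R) w ≈F coefficient R w
  coefficient-∷-other x u w R ne with u ≟W w
  ... | yes p = ⊥-elim (ne p)
  ... | no _ = 𝔽.refl

  ∷-congᶜ : ∀ {x y} w {P Q} → x ≈F y → P ≈ᶜ Q → ((x , w) ∷ P) ≈ᶜ ((y , w) ∷ Q)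
  ∷-congᶜ w h h′ u with w ≟W u
  ... | yes _ = 𝔽.+-cong h (h′ u)
  ... | no _ = h′ u

  ∷-cong : ∀ {x y} w {P Q} → x ≈F y → P ≈ᶠ Q → ((x , w) ∷ P) ≈ᶠ ((y , w) ∷ Q)
  ∷-cong w h (mk≈ᶠ h′) = mk≈ᶠ (∷-congᶜ w h h′)

  filter≡ filter≢ : W → Combination → Combination
  filter≡ w [] = []
  filter≡ w ((x , u) ∷ P) with u ≟W w
  ... | yes _ = (x , u) ∷ filter≡ w P
  ... | no _ = filter≡ w P

  filter≢ w [] = []
  filter≢ w ((x , u) ∷ P) with u ≟W w
  ... | yes _ = filter≢ w P
  ... | no _ = (x , u) ∷ filter≢ w P

  length-filter≢ : ∀ w P → length (filter≢ w P) ≤ length P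
  length-filter≢ w [] = z≤n
  length-filter≢ w ((x , u) ∷ P) with u ≟W w
  ... | yes _ = ℕₚ.≤-trans (length-filter≢ w P) (ℕₚ.n≤1+n _)
  ... | no _ = s≤s (length-filter≢ w P)

  coefficient-filter≢-same : ∀ w P → coefficient (filter≢ w P) w ≈F 0#
  coefficient-filter≢-same w [] = 𝔽.refl
  coefficient-filter≢-same w ((x , u) ∷ P) with u ≟W w
  ... | yes _ = coefficient-filter≢-same w P
  ... | no ne = 𝔽.trans (coefficient-∷-other x u w (filter≢ w P) ne) (coefficient-filter≢-same w P)

  coefficient-filter≢-other : ∀ w u P → ¬ u ≡ w → coefficient (filter≢ w P) u ≈F coefficient P u
  coefficient-filter≢-other w u [] ne = 𝔽.refl
  coefficient-filter≢-other w u ((x , v) ∷ P) ne with v ≟W w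
  ... | yes ≡.refl = 𝔽.trans (coefficient-filter≢-other w u P ne) (𝔽.sym (coefficient-∷-other x v u P (λ e → ne (≡.sym e))))
  ... | no _ with v ≟W u
  ...   | yes _ = 𝔽.+-cong 𝔽.refl (coefficient-filter≢-other w u P ne)
  ...   | no _ = coefficient-filter≢-other w u P ne

  module _ {v e} (S : LinearSpace F v e) where
    open LinearSpace S
    open LinearSpaceProperties S

    extend : (W → V) → Combination → V
    extend f [] = 0V
    extend f ((x , w) ∷ P) = x ·V f w +V extend f P

    extend-split : ∀ f w P → extend f P ≈V extend f (filter≡ w P) +V extend f (filter≢ w P)
    extend-split f w [] = symV (+V-idˡ 0V)
    extend-split f w ((x , u) ∷ P) with u ≟W w
    ... | yes _ = transV (+V-cong reflV (extend-split f w P)) (symV (+V-assoc _ _ _))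
    ... | no _ = transV (+V-cong reflV (extend-split f w P))
                 (transV (symV (+V-assoc _ _ _)) (transV (+V-cong (+V-comm _ _) reflV) (+V-assoc _ _ _)))

    extend-filter≡ : ∀ f w P → extend f (filter≡ w P) ≈V coefficient P w ·V f w
    extend-filter≡ f w [] = symV (·V-zero _)
    extend-filter≡ f w ((x , u) ∷ P) with u ≟W w
    ... | yes ≡.refl = transV (+V-cong reflV (extend-filter≡ f u P)) (symV (·V-distʳ _ _ _))
    ... | no _ = extend-filter≡ f w P

    -- Induction on the number of terms: the terms on the first word w add up to
    -- coefficient P w ·V f w = 0# ·V f w, and the others form a shorter combination.
    extend-null : ∀ n f P → length P ≤ n → P ≈ᶜ [] → extend f P ≈V 0V
    extend-null n f [] _ _ = reflV
    extend-null (suc n) f ((x , w) ∷ R) (s≤s le) h =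
      transV (+V-cong reflV (extend-split f w R))
      (transV (symV (+V-assoc _ _ _))
      (transV (+V-cong (transV (+V-cong reflV (extend-filter≡ f w R))
                       (transV (symV (·V-distʳ _ _ _))
                       (transV (·V-cong (𝔽.trans (𝔽.sym (coefficient-∷-same x w R)) (h w)) reflV)
                       (·V-zero _)))) ih)
      (+V-idˡ _)))
      where
        h′ : filter≢ w R ≈ᶜ []
        h′ u with u ≟W w
        ... | yes ≡.refl = coefficient-filter≢-same u R
        ... | no ne = 𝔽.trans (coefficient-filter≢-other w u R ne) (𝔽.trans (𝔽.sym (coefficient-∷-other x w u R (λ e → ne (≡.sym e)))) (h u))
        ih = extend-null n f (filter≢ w R) (ℕₚ.≤-trans (length-filter≢ w R) le) h′

    extend-++ : ∀ f P Q → extend f (P ++ Q) ≈V extend f P +V extend f Q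
    extend-++ f [] Q = symV (+V-idˡ _)
    extend-++ f ((x , w) ∷ P) Q = transV (+V-cong reflV (extend-++ f P Q)) (symV (+V-assoc _ _ _))

    extend-· : ∀ f x P → extend f (x ·ᶠ P) ≈V x ·V extend f P
    extend-· f x [] = symV (·V-zeroʳ x)
    extend-· f x ((y , w) ∷ P) = transV (+V-cong (·V-assoc _ _ _) (extend-· f x P)) (symV (·V-distˡ _ _ _))

    extend-resp : ∀ f {P Q} → P ≈ᶠ Q → extend f P ≈V extend f Q
    extend-resp f {P} {Q} (mk≈ᶠ h) = ≈V-from-difference _ _
      (transV (+V-cong reflV (symV (extend-· f (- 1#) Q)))
      (transV (symV (extend-++ f P ((- 1#) ·ᶠ Q)))
       (extend-null _ f (P ++ (- 1#) ·ᶠ Q) ℕₚ.≤-refl hz)))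
      where
        hz : (P ++ (- 1#) ·ᶠ Q) ≈ᶜ []
        hz w = 𝔽.trans (coefficient-++ P _ w) (𝔽.trans (𝔽.+-cong (h w) (coefficient-· (- 1#) Q w)) (x+-1x≈0 _))
          where open RingProperties 𝔽.ring using (-1*x≈-x)
                x+-1x≈0 : ∀ x → x 𝔽.+ (- 1#) 𝔽.* x ≈F 0#
                x+-1x≈0 x = 𝔽.trans (𝔽.+-cong 𝔽.refl (-1*x≈-x x)) (𝔽.-‿inverseʳ x)

    extend-cong : ∀ {f g} → (∀ w → f w ≈V g w) → ∀ P → extend f P ≈V extend g P
    extend-cong h [] = reflV
    extend-cong h ((x , w) ∷ P) = +V-cong (·V-cong 𝔽.refl (h w)) (extend-cong h P)

    extend-+ᶠ : ∀ f g P → extend (λ w → f w +V g w) P ≈V extend f P +V extend g P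
    extend-+ᶠ f g [] = symV (+V-idˡ 0V)
    extend-+ᶠ f g ((x , w) ∷ P) =
      transV (+V-cong (·V-distˡ _ _ _) (extend-+ᶠ f g P)) (+V-interchange _ _ _ _)

    extend-·ᶠ : ∀ x f P → extend (λ w → x ·V f w) P ≈V x ·V extend f P
    extend-·ᶠ x f [] = symV (·V-zeroʳ x)
    extend-·ᶠ x f ((y , w) ∷ P) =
      transV (+V-cong (transV (symV (·V-assoc _ _ _)) (transV (·V-cong (𝔽.*-comm _ _) reflV) (·V-assoc _ _ _))) (extend-·ᶠ x f P))
             (symV (·V-distˡ _ _ _))

    extend-0ᶠ : ∀ P → extend (λ _ → 0V) P ≈V 0V
    extend-0ᶠ [] = reflV
    extend-0ᶠ ((x , w) ∷ P) = transV (+V-cong (·V-zeroʳ x) (extend-0ᶠ P)) (+V-idˡ 0V)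

  combinationSpace : LinearSpace F c ℓ
  combinationSpace = record
    { V = Combination ; _≈V_ = _≈ᶠ_ ; 0V = [] ; _+V_ = _++_ ; _·V_ = _·ᶠ_
    ; reflV = mk≈ᶠ (λ w → 𝔽.refl) ; symV = λ (mk≈ᶠ h) → mk≈ᶠ (λ w → 𝔽.sym (h w)) ; transV = λ (mk≈ᶠ h) (mk≈ᶠ h′) → mk≈ᶠ (λ w → 𝔽.trans (h w) (h′ w))
    ; +V-cong = λ {s} {s′} {t} {t′} (mk≈ᶠ h) (mk≈ᶠ h′) → mk≈ᶠ λ w → 𝔽.trans (coefficient-++ s t w) (𝔽.trans (𝔽.+-cong (h w) (h′ w)) (𝔽.sym (coefficient-++ s′ t′ w)))
    ; ·V-cong = λ {x} {y} {s} {t} h (mk≈ᶠ h′) → mk≈ᶠ λ w → 𝔽.trans (coefficient-· x s w) (𝔽.trans (𝔽.*-cong h (h′ w)) (𝔽.sym (coefficient-· y t w)))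
    ; +V-assoc = λ s t u → mk≈ᶠ λ w → 𝔽.reflexive (≡.cong (λ xs → coefficient xs w) (Listₚ.++-assoc s t u))
    ; +V-comm = λ s t → mk≈ᶠ λ w → 𝔽.trans (coefficient-++ s t w) (𝔽.trans (𝔽.+-comm _ _) (𝔽.sym (coefficient-++ t s w)))
    ; +V-idˡ = λ s → mk≈ᶠ λ w → 𝔽.refl
    ; ·V-zero = λ s → mk≈ᶠ λ w → 𝔽.trans (coefficient-· 0# s w) (𝔽.zeroˡ _)
    ; ·V-one = λ s → mk≈ᶠ λ w → 𝔽.trans (coefficient-· 1# s w) (𝔽.*-identityˡ _)
    ; ·V-assoc = λ x y s → mk≈ᶠ λ w → 𝔽.trans (coefficient-· _ s w) (𝔽.trans (𝔽.*-assoc _ _ _)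
                   (𝔽.sym (𝔽.trans (coefficient-· x (y ·ᶠ s) w) (𝔽.*-cong 𝔽.refl (coefficient-· y s w)))))
    ; ·V-distʳ = λ x y s → mk≈ᶠ λ w → 𝔽.trans (coefficient-· _ s w) (𝔽.trans (𝔽.distribʳ _ _ _)
                   (𝔽.sym (𝔽.trans (coefficient-++ (x ·ᶠ s) (y ·ᶠ s) w) (𝔽.+-cong (coefficient-· x s w) (coefficient-· y s w)))))
    ; ·V-distˡ = λ x s t → mk≈ᶠ λ w → 𝔽.trans (coefficient-· x (s ++ t) w) (𝔽.trans (𝔽.*-cong 𝔽.refl (coefficient-++ s t w))
                   (𝔽.trans (𝔽.distribˡ _ _ _)
                   (𝔽.sym (𝔽.trans (coefficient-++ (x ·ᶠ s) (x ·ᶠ t) w) (𝔽.+-cong (coefficient-· x s w) (coefficient-· x t w))))))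
    }

  extend-id′ : ∀ P → extend combinationSpace (λ w → (1# , w) ∷ []) P ≈ᶜ P
  extend-id′ [] w = 𝔽.refl
  extend-id′ ((x , u) ∷ P) w with u ≟W w
  ... | yes _ = 𝔽.+-cong (𝔽.*-identityʳ x) (extend-id′ P w)
  ... | no _ = extend-id′ P w

  extend-id : ∀ P → extend combinationSpace (λ w → (1# , w) ∷ []) P ≈ᶠ P
  extend-id P = mk≈ᶠ (extend-id′ P)

module FormalSum₂ {c ℓ} (F : Field c ℓ) {W₁ W₂ : Set} (_≟₁_ : DecidableEquality W₁) (_≟₂_ : DecidableEquality W₂) where
  module G₁ = FormalSum F _≟₁_
  module G₂ = FormalSum F _≟₂_

  module _ {v e} (S : LinearSpace F v e) where
    open LinearSpace S
    open LinearSpaceProperties S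

    extend-extend : ∀ (f : W₁ → G₂.Combination) (g : W₂ → V) P →
                G₂.extend S g (G₁.extend G₂.combinationSpace f P) ≈V G₁.extend S (λ w → G₂.extend S g (f w)) P
    extend-extend f g [] = reflV
    extend-extend f g ((x , w) ∷ P) =
      transV (G₂.extend-++ S g (x G₂.·ᶠ f w) _) (+V-cong (G₂.extend-· S g x (f w)) (extend-extend f g P))

    extend-swap : ∀ (f : W₁ → W₂ → V) A B →
             G₁.extend S (λ r → G₂.extend S (f r) B) A ≈V G₂.extend S (λ u → G₁.extend S (λ r → f r u) A) B
    extend-swap f [] B = symV (G₂.extend-0ᶠ S B)
    extend-swap f ((x , r) ∷ A) B =
      transV (+V-cong (symV (G₂.extend-·ᶠ S x (f r) B)) (extend-swap f A B)) (symV (G₂.extend-+ᶠ S _ _ B))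

module LinearMap {c ℓ} (F : Field c ℓ) {W : Set} (_≟W_ : DecidableEquality W)
  {v e v′ e′} (S : LinearSpace F v e) (S′ : LinearSpace F v′ e′) where
  open FormalSum F _≟W_
  module S = LinearSpace S
  module S′ = LinearSpace S′

  extend-linear : (φ : S.V → S′.V) → (∀ s t → φ (s S.+V t) S′.≈V (φ s S′.+V φ t)) →
           (∀ x s → φ (x S.·V s) S′.≈V (x S′.·V φ s)) → φ S.0V S′.≈V S′.0V →
           ∀ f P → φ (extend S f P) S′.≈V extend S′ (λ w → φ (f w)) P
  extend-linear φ h+ h· h0 f [] = h0
  extend-linear φ h+ h· h0 f ((x , w) ∷ P) = S′.transV (h+ _ _) (S′.+V-cong (h· x (f w)) (extend-linear φ h+ h· h0 f P))

-- Words as lists of indices, where splicing is plain list surgery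

spliceList : List ℕ → ℕ → List ℕ → List ℕ
spliceList [] _ v = v
spliceList (x ∷ w) zero v = v ++ w
spliceList (x ∷ w) (suc i) v = x ∷ spliceList w i v

lookupList : List ℕ → ℕ → ℕ
lookupList [] _ = 0
lookupList (x ∷ w) zero = x
lookupList (x ∷ w) (suc i) = lookupList w i

derivList : List ℕ → List (List ℕ)
derivList [] = []
derivList (x ∷ l) = (suc x ∷ l) ∷ List.map (x ∷_) (derivList l)

tab-cast : ∀ {m n} (e : m ≡ n) (g : Fin n → ℕ) → toList (tabulate (λ j → g (cast e j))) ≡ toList (tabulate g)
tab-cast refl g = cong toList (tabulate-cong (λ j → cong g (Finₚ.cast-is-id refl j)))

lookup≡lookupList : ∀ {n} (w : Vec ℕ n) i → lookup w i ≡ lookupList (toList w) (toℕ i)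
lookup≡lookupList (x ∷ w) zero = refl
lookup≡lookupList (x ∷ w) (suc i) = lookup≡lookupList w i

src₀-inj₂ : ∀ a b j k → src₀ a b j ≡ inj₂ k → toℕ j ≡ toℕ k
src₀-inj₂ a zero zero k refl = refl
src₀-inj₂ a zero (suc j) k ()
src₀-inj₂ a (suc b) zero k refl = refl
src₀-inj₂ a (suc b) (suc j) k h with src₀ a b (cast (+-suc a b) j) in eq
src₀-inj₂ a (suc b) (suc j) k () | inj₁ _
src₀-inj₂ a (suc b) (suc j) .(suc k′) refl | inj₂ k′ =
  cong suc (trans (sym (toℕ-cast (+-suc a b) j)) (src₀-inj₂ a b _ k′ eq))

src₀-inj₁ : ∀ a b j k → src₀ a b j ≡ inj₁ k → (0 < toℕ k) × (toℕ j ≡ toℕ k + b)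
src₀-inj₁ a zero zero k ()
src₀-inj₁ a zero (suc j) .(suc (cast (+-identityʳ a) j)) refl =
  s≤s z≤n , cong suc (trans (sym (toℕ-cast (+-identityʳ a) j)) (sym (+-identityʳ _)))
src₀-inj₁ a (suc b) zero k ()
src₀-inj₁ a (suc b) (suc j) k h with src₀ a b (cast (+-suc a b) j) in eq
src₀-inj₁ a (suc b) (suc j) k () | inj₂ _
src₀-inj₁ a (suc b) (suc j) .k′ refl | inj₁ k′ with src₀-inj₁ a b _ k′ eq
... | p , q = p , trans (cong suc (trans (sym (toℕ-cast (+-suc a b) j)) q)) (sym (+-suc (toℕ k′) b))

src-inj₂ : ∀ {a b} i j k → src {a} {b} i j ≡ inj₂ k → toℕ j ≡ toℕ i + toℕ k
src-inj₂ {a} {b} zero j k h = src₀-inj₂ a b j k h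
src-inj₂ {suc a} {b} (suc i) zero k ()
src-inj₂ {suc a} {b} (suc i) (suc j) k h with src {a} {b} i j in eq
src-inj₂ {suc a} {b} (suc i) (suc j) k () | inj₁ _
src-inj₂ {suc a} {b} (suc i) (suc j) .k′ refl | inj₂ k′ = cong suc (src-inj₂ i j k′ eq)

src-inj₁ : ∀ {a b} i j k → src {a} {b} i j ≡ inj₁ k →
           ((toℕ j < toℕ i) × (toℕ k ≡ toℕ j)) ⊎ ((toℕ i < toℕ k) × (toℕ j ≡ toℕ k + b))
src-inj₁ {a} {b} zero j k h with src₀-inj₁ a b j k h
... | p , q = inj₂ (p , q)
src-inj₁ {suc a} {b} (suc i) zero .zero refl = inj₁ (s≤s z≤n , refl)
src-inj₁ {suc a} {b} (suc i) (suc j) k h with src {a} {b} i j in eq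
src-inj₁ {suc a} {b} (suc i) (suc j) k () | inj₂ _
src-inj₁ {suc a} {b} (suc i) (suc j) .(suc k′) refl | inj₁ k′ with src-inj₁ i j k′ eq
... | inj₁ (p , q) = inj₁ (s≤s p , cong suc q)
... | inj₂ (p , q) = inj₂ (s≤s p , cong suc q)

spliceList-++ˡ : ∀ v w k r → k < length v → spliceList (v ++ w) k r ≡ spliceList v k r ++ w
spliceList-++ˡ (x ∷ v) w zero r _ = sym (Listₚ.++-assoc r v w)
spliceList-++ˡ (x ∷ v) w (suc k) r (s≤s h) = cong (x ∷_) (spliceList-++ˡ v w k r h)

spliceList-++ʳ : ∀ r w i v → spliceList (r ++ w) (length r + i) v ≡ r ++ spliceList w i v
spliceList-++ʳ [] w i v = refl
spliceList-++ʳ (x ∷ r) w i v = cong (x ∷_) (spliceList-++ʳ r w i v)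

spliceList-seq : ∀ w i v k r → i < length w → k < length v → spliceList (spliceList w i v) (i + k) r ≡ spliceList w i (spliceList v k r)
spliceList-seq (x ∷ w) zero v k r _ hk = spliceList-++ˡ v w k r hk
spliceList-seq (x ∷ w) (suc i) v k r (s≤s hi) hk = cong (x ∷_) (spliceList-seq w i v k r hi hk)

spliceList-par : ∀ w k i r v d → k < i → i < length w → length r ≡ suc d →
       spliceList (spliceList w i v) k r ≡ spliceList (spliceList w k r) (i + d) v
spliceList-par (x ∷ w) zero (suc i) r v d _ _ hr =
  sym (trans (cong (λ n → spliceList (r ++ w) n v) (trans (cong suc (+-comm i d)) (cong (_+ i) (sym hr))))
             (spliceList-++ʳ r w i v))
spliceList-par (x ∷ w) (suc k) (suc i) r v d (s≤s hk) (s≤s hi) hr = cong (x ∷_) (spliceList-par w k i r v d hk hi hr)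

spliceList-par′ : ∀ tw tv tr ti tj tk tj′ b d → length tv ≡ suc b → length tr ≡ suc d →
          ti < length tw → tk < length tw →
          ((tj < ti) × (tk ≡ tj)) ⊎ ((ti < tk) × (tj ≡ tk + b)) →
          ((tj′ < tk) × (ti ≡ tj′)) ⊎ ((tk < ti) × (tj′ ≡ ti + d)) →
          spliceList (spliceList tw ti tv) tj tr ≡ spliceList (spliceList tw tk tr) tj′ tv
spliceList-par′ tw tv tr ti tj tk tj′ b d hv hr hi hk (inj₁ (p , refl)) (inj₂ (q , refl)) = spliceList-par tw tk ti tr tv d q hi hr
spliceList-par′ tw tv tr ti tj tk tj′ b d hv hr hi hk (inj₂ (p , refl)) (inj₁ (q , refl)) = sym (spliceList-par tw ti tk tv tr b p hk hv)
spliceList-par′ tw tv tr ti tj tk tj′ b d hv hr hi hk (inj₁ (p , refl)) (inj₁ (q , refl)) = ⊥-elim (ℕₚ.<-asym p q)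
spliceList-par′ tw tv tr ti tj tk tj′ b d hv hr hi hk (inj₂ (p , refl)) (inj₂ (q , refl)) = ⊥-elim (ℕₚ.<-asym p q)

spliceList-unit : ∀ w i → i < length w → spliceList w i (lookupList w i ∷ []) ≡ w
spliceList-unit (x ∷ w) zero _ = refl
spliceList-unit (x ∷ w) (suc i) (s≤s h) = cong (x ∷_) (spliceList-unit w i h)

derivList-++ : ∀ u v → derivList (u ++ v) ≡ List.map (_++ v) (derivList u) List.++ List.map (u ++_) (derivList v)
derivList-++ [] v = sym (Listₚ.map-id (derivList v))
derivList-++ (x ∷ u) v = cong ((suc x ∷ u ++ v) ∷_) (begin
    List.map (x ∷_) (derivList (u ++ v))
  ≡⟨ cong (List.map (x ∷_)) (derivList-++ u v) ⟩
    List.map (x ∷_) (List.map (_++ v) (derivList u) ++ List.map (u ++_) (derivList v))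
  ≡⟨ Listₚ.map-++ (x ∷_) (List.map (_++ v) (derivList u)) _ ⟩
    List.map (x ∷_) (List.map (_++ v) (derivList u)) ++ List.map (x ∷_) (List.map (u ++_) (derivList v))
  ≡⟨ ≡.cong₂ _++_ (trans (sym (Listₚ.map-∘ (derivList u))) (Listₚ.map-∘ (derivList u))) (sym (Listₚ.map-∘ (derivList v))) ⟩
    List.map (_++ v) (List.map (x ∷_) (derivList u)) ++ List.map ((x ∷ u) ++_) (derivList v) ∎)
  where open ≡.≡-Reasoning

toList-injective : ∀ {n} {u w : Vec ℕ n} → toList u ≡ toList w → u ≡ w
toList-injective {n} {u} {w} h = trans (sym (Vecₚ.cast-is-id refl u)) (Vecₚ.toList-injective refl u w h)

map-toList-injective : ∀ {n} {L L′ : List (Vec ℕ n)} → List.map toList L ≡ List.map toList L′ → L ≡ L′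
map-toList-injective {L = []} {[]} h = refl
map-toList-injective {L = x ∷ L} {y ∷ L′} h = ≡.cong₂ _∷_ (toList-injective (Listₚ.∷-injectiveˡ h)) (map-toList-injective (Listₚ.∷-injectiveʳ h))

module Splicing {c ℓ} (F : Field c ℓ) where
  open Over F

  toList-splice₀ : ∀ a b (x : ℕ) (w′ : Vec ℕ a) (v : Word b) →
        toList (tabulate (λ j → [ lookup (x ∷ w′) , lookup v ] (src₀ a b j))) ≡ toList v ++ toList w′
  toList-splice₀ a zero x w′ (m ∷ []) = cong (m ∷_) (trans (tab-cast (+-identityʳ a) (lookup w′)) (cong toList (tabulate∘lookup w′)))
  toList-splice₀ a (suc b) x w′ (m ∷ v′) = cong (m ∷_) (trans (cong toList (tabulate-cong pointwise)) (trans (tab-cast (+-suc a b) g) (toList-splice₀ a b x w′ v′)))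
    where
    g : Fin (suc (a + b)) → ℕ
    g j = [ lookup (x ∷ w′) , lookup v′ ] (src₀ a b j)
    pointwise : ∀ j → [ lookup (x ∷ w′) , lookup (m ∷ v′) ] (map⊎ id suc (src₀ a b (cast (+-suc a b) j))) ≡ g (cast (+-suc a b) j)
    pointwise j = Sumₚ.[,]-map (src₀ a b (cast (+-suc a b) j))

  toList-splice : ∀ {a b} (w : Word a) i (v : Word b) → toList (splice w i v) ≡ spliceList (toList w) (toℕ i) (toList v)
  toList-splice {a} {b} (x ∷ w′) zero v = toList-splice₀ a b x w′ v
  toList-splice {suc a} {b} (x ∷ w′) (suc i) v = cong (x ∷_) (trans (cong toList (tabulate-cong pointwise)) (toList-splice w′ i v))
    where
    pointwise : ∀ j → [ lookup (x ∷ w′) , lookup v ] (map⊎ suc id (src {a} {b} i j)) ≡ [ lookup w′ , lookup v ] (src i j)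
    pointwise j = Sumₚ.[,]-map (src {a} {b} i j)

module NMIOperad {c ℓ} (F : Field c ℓ) where
  open Over F
  open Field F using (Carrier; 0#; 1#) renaming (_≈_ to _≈F_; _+_ to _+F_; _*_ to _*F_)
  private module 𝔽 = Field F
  open Splicing F

  _≟ʷ_ : ∀ {a} → DecidableEquality (Word a)
  _≟ʷ_ = ≡-dec ℕ._≟_

  module FS (a : ℕ) = FormalSum F (_≟ʷ_ {a})
  module FS₂ (a b : ℕ) = FormalSum₂ F (_≟ʷ_ {a}) (_≟ʷ_ {b})

  nmiSpace : ℕ → LinearSpace F c ℓ
  nmiSpace a = FS.combinationSpace a

  infix 4 _≋_
  _≋_ : ∀ {a} → NMI a → NMI a → Set ℓ
  _≋_ {a} = FS._≈ᶠ_ a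

  infixr 7 _·ᶠ_
  _·ᶠ_ : ∀ {a} → Carrier → NMI a → NMI a
  _·ᶠ_ {a} = FS._·ᶠ_ a

  lin : ∀ {a b} → (Word a → NMI b) → NMI a → NMI b
  lin {a} {b} = FS.extend a (nmiSpace b)

  module _ {a : ℕ} where
    open LinearSpace (nmiSpace a) public using () renaming
      (reflV to ≋refl; symV to ≋sym; transV to ≋trans; +V-cong to ++cong; ·V-cong to ·cong;
       +V-assoc to ++assoc; +V-comm to ++comm; ·V-one to ·one; ·V-distˡ to ·distˡ)
    open LinearSpaceProperties (nmiSpace a) public using () renaming (+V-idʳ to ++idʳ)

  ≡⇒≋ : ∀ {a} {P Q : NMI a} → P ≡ Q → P ≋ Q
  ≡⇒≋ refl = ≋refl

  basis : ∀ {a} → Word a → NMI a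
  basis w = (1# , w) ∷ []

  basisSum : ∀ {a} → List (Word a) → NMI a
  basisSum = List.map (λ w → (1# , w))

  mapWords : ∀ {a b} → (Word a → Word b) → NMI a → NMI b
  mapWords f = List.map (λ p → (proj₁ p , f (proj₂ p)))

  lin-resp : ∀ {a b} (f : Word a → NMI b) {P Q} → P ≋ Q → lin f P ≋ lin f Q
  lin-resp {a} {b} f = FS.extend-resp a (nmiSpace b) f

  lin-cong : ∀ {a b} {f g : Word a → NMI b} → (∀ w → f w ≋ g w) → ∀ P → lin f P ≋ lin g P
  lin-cong {a} {b} = FS.extend-cong a (nmiSpace b)

  lin-· : ∀ {a b} (f : Word a → NMI b) x P → lin f (x ·ᶠ P) ≋ x ·ᶠ lin f P
  lin-· {a} {b} = FS.extend-· a (nmiSpace b)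

  lin-+ᶠ : ∀ {a b} (f g : Word a → NMI b) P → lin (λ w → f w ++ g w) P ≋ lin f P ++ lin g P
  lin-+ᶠ {a} {b} = FS.extend-+ᶠ a (nmiSpace b)

  lin-·ᶠ : ∀ {a b} x (f : Word a → NMI b) P → lin (λ w → x ·ᶠ f w) P ≋ x ·ᶠ lin f P
  lin-·ᶠ {a} {b} = FS.extend-·ᶠ a (nmiSpace b)

  lin-lin : ∀ {a b d} (f : Word a → NMI b) (g : Word b → NMI d) P → lin g (lin f P) ≋ lin (λ w → lin g (f w)) P
  lin-lin {a} {b} {d} f g P = FS₂.extend-extend a b (nmiSpace d) f g P

  lin-swap : ∀ {a b d} (f : Word a → Word b → NMI d) A B → lin (λ r → lin (f r) B) A ≋ lin (λ u → lin (λ r → f r u) A) B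
  lin-swap {a} {b} {d} f A B = FS₂.extend-swap a b (nmiSpace d) f A B

  lin-id : ∀ {a} P → lin {a} basis P ≋ P
  lin-id {a} = FS.extend-id a

  ∷-cong : ∀ {a x y} (w : Word a) {P Q} → x ≈F y → P ≋ Q → ((x , w) ∷ P) ≋ ((y , w) ∷ Q)
  ∷-cong {a} = FS.∷-cong a

  linear-lin : ∀ {a b d} (φ : NMI b → NMI d) →
         (∀ P Q → φ (P ++ Q) ≋ φ P ++ φ Q) → (∀ x P → φ (x ·ᶠ P) ≋ x ·ᶠ φ P) → φ [] ≋ [] →
         ∀ (f : Word a → NMI b) P → φ (lin f P) ≋ lin (φ ∘ f) P
  linear-lin φ h+ h· h0 f [] = h0
  linear-lin φ h+ h· h0 f ((x , w) ∷ P) = ≋trans (h+ _ _) (++cong (h· x (f w)) (linear-lin φ h+ h· h0 f P))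

  lin-basisSum-map : ∀ {a b d} (f : Word b → NMI d) (g : Word a → Word b) (Ls : List (Word a)) →
              lin f (basisSum (List.map g Ls)) ≡ lin (f ∘ g) (basisSum Ls)
  lin-basisSum-map f g [] = refl
  lin-basisSum-map f g (w ∷ Ls) = cong (_ ++_) (lin-basisSum-map f g Ls)

  lin-mapWords : ∀ {a b d} (f : Word b → NMI d) (g : Word a → Word b) P → lin f (mapWords g P) ≡ lin (f ∘ g) P
  lin-mapWords f g [] = refl
  lin-mapWords f g ((x , w) ∷ P) = cong (_ ++_) (lin-mapWords f g P)

  ·-basisSum : ∀ {a} x (Ls : List (Word a)) → x ·ᶠ basisSum Ls ≋ List.map (λ v → (x , v)) Ls
  ·-basisSum x [] = ≋refl
  ·-basisSum x (w ∷ Ls) = ∷-cong w (𝔽.*-identityʳ x) (·-basisSum x Ls)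

  mapWords-as-lin : ∀ {a b} (f : Word a → Word b) P → mapWords f P ≋ lin (λ w → basis (f w)) P
  mapWords-as-lin f [] = ≋refl
  mapWords-as-lin f ((x , w) ∷ P) = ∷-cong (f w) (𝔽.sym (𝔽.*-identityʳ x)) (mapWords-as-lin f P)

  mapWords-++ : ∀ {a b} (f : Word a → Word b) P Q → mapWords f (P ++ Q) ≡ mapWords f P ++ mapWords f Q
  mapWords-++ f P Q = Listₚ.map-++ _ P Q

  mapWords-· : ∀ {a b} (f : Word a → Word b) x P → mapWords f (x ·ᶠ P) ≡ x ·ᶠ mapWords f P
  mapWords-· f x [] = refl
  mapWords-· f x ((y , w) ∷ P) = cong (_ ∷_) (mapWords-· f x P)

  mapWords-resp : ∀ {a b} (f : Word a → Word b) {P Q} → P ≋ Q → mapWords f P ≋ mapWords f Q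
  mapWords-resp f {P} {Q} h = ≋trans (mapWords-as-lin f P) (≋trans (lin-resp _ h) (≋sym (mapWords-as-lin f Q)))

  mapWords-lin : ∀ {a b d} (g : Word b → Word d) (f : Word a → NMI b) P → mapWords g (lin f P) ≋ lin (mapWords g ∘ f) P
  mapWords-lin g = linear-lin (mapWords g) (λ P Q → ≡⇒≋ (mapWords-++ g P Q)) (λ x P → ≡⇒≋ (mapWords-· g x P)) ≋refl

  mapWords-∘ : ∀ {a b d} (g : Word b → Word d) (f : Word a → Word b) P → mapWords g (mapWords f P) ≡ mapWords (g ∘ f) P
  mapWords-∘ g f P = sym (Listₚ.map-∘ P)

  mapWords-cong : ∀ {a b} {f g : Word a → Word b} → (∀ w → f w ≡ g w) → ∀ P → mapWords f P ≡ mapWords g P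
  mapWords-cong h P = Listₚ.map-cong (λ p → cong (proj₁ p ,_) (h (proj₂ p))) P

  mapWords-id : ∀ {a} (P : NMI a) → mapWords id P ≡ P
  mapWords-id P = Listₚ.map-id P

  mapWords-basisSum : ∀ {a b} (f : Word a → Word b) Ls → mapWords f (basisSum Ls) ≡ basisSum (List.map f Ls)
  mapWords-basisSum f Ls = trans (sym (Listₚ.map-∘ Ls)) (Listₚ.map-∘ Ls)

  basisSum-++ : ∀ {a} (A B : List (Word a)) → basisSum (A ++ B) ≡ basisSum A ++ basisSum B
  basisSum-++ A B = Listₚ.map-++ _ A B

  basisSum-map-as-lin : ∀ {a b} (h : Word a → Word b) Ls → basisSum (List.map h Ls) ≋ lin (λ u → basis (h u)) (basisSum Ls)
  basisSum-map-as-lin h Ls = ≋trans (≡⇒≋ (sym (mapWords-basisSum h Ls))) (mapWords-as-lin h (basisSum Ls))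

  D-++ : ∀ {a} (P Q : NMI a) → D (P ++ Q) ≡ D P ++ D Q
  D-++ P Q = Listₚ.concatMap-++ _ P Q

  D-· : ∀ {a} x (P : NMI a) → D (x ·ᶠ P) ≡ x ·ᶠ D P
  D-· x [] = refl
  D-· x ((y , w) ∷ P) = trans (cong (List.map (λ v → (x *F y , v)) (Dword w) ++_) (D-· x P))
    (sym (trans (Listₚ.map-++ (λ p → (x *F proj₁ p , proj₂ p)) (List.map (λ v → (y , v)) (Dword w)) (D P))
                (cong (_++ (x ·ᶠ D P)) (sym (Listₚ.map-∘ (Dword w))))))

  D-as-lin : ∀ {a} (P : NMI a) → D P ≋ lin (λ w → basisSum (Dword w)) P
  D-as-lin [] = ≋refl
  D-as-lin ((x , w) ∷ P) = ++cong (≋sym (·-basisSum x (Dword w))) (D-as-lin P)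

  D-resp : ∀ {a} {P Q : NMI a} → P ≋ Q → D P ≋ D Q
  D-resp {P = P} {Q} h = ≋trans (D-as-lin P) (≋trans (lin-resp _ h) (≋sym (D-as-lin Q)))

  Dⁿ-++ : ∀ {a} n (P Q : NMI a) → Dⁿ n (P ++ Q) ≡ Dⁿ n P ++ Dⁿ n Q
  Dⁿ-++ zero P Q = refl
  Dⁿ-++ (suc n) P Q = trans (cong D (Dⁿ-++ n P Q)) (D-++ (Dⁿ n P) (Dⁿ n Q))

  Dⁿ-· : ∀ {a} n x (P : NMI a) → Dⁿ n (x ·ᶠ P) ≡ x ·ᶠ Dⁿ n P
  Dⁿ-· zero x P = refl
  Dⁿ-· (suc n) x P = trans (cong D (Dⁿ-· n x P)) (D-· x (Dⁿ n P))

  Dⁿ-resp : ∀ {a} n {P Q : NMI a} → P ≋ Q → Dⁿ n P ≋ Dⁿ n Q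
  Dⁿ-resp zero h = h
  Dⁿ-resp (suc n) h = D-resp (Dⁿ-resp n h)

  D-lin : ∀ {a b} (f : Word a → NMI b) P → D (lin f P) ≋ lin (D ∘ f) P
  D-lin = linear-lin D (λ P Q → ≡⇒≋ (D-++ P Q)) (λ x P → ≡⇒≋ (D-· x P)) ≋refl

  wordComp : ∀ {a b} → Word a → Fin (suc a) → NMI b → NMI (a + b)
  wordComp w i Q = mapWords (splice w i) (Dⁿ (lookup w i) Q)

  ∘ᴺ-as-lin : ∀ {a b} (P : NMI a) i (Q : NMI b) → P ∘ᴺ[ i ] Q ≡ lin (λ w → wordComp w i Q) P
  ∘ᴺ-as-lin [] i Q = refl
  ∘ᴺ-as-lin ((x , w) ∷ P) i Q = ≡.cong₂ _++_
    (trans (Listₚ.map-cong (λ { (y , v) → refl }) (Dⁿ (lookup w i) Q)) (Listₚ.map-∘ (Dⁿ (lookup w i) Q)))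
    (∘ᴺ-as-lin P i Q)

  wordComp-resp : ∀ {a b} (w : Word a) i {Q Q′ : NMI b} → Q ≋ Q′ → wordComp w i Q ≋ wordComp w i Q′
  wordComp-resp w i h = mapWords-resp (splice w i) (Dⁿ-resp (lookup w i) h)

  ∘ᴺ-resp : ∀ {a b} {P P′ : NMI a} i {Q Q′ : NMI b} → P ≋ P′ → Q ≋ Q′ → P ∘ᴺ[ i ] Q ≋ P′ ∘ᴺ[ i ] Q′
  ∘ᴺ-resp {P = P} {P′} i {Q} {Q′} hP hQ =
    ≋trans (≡⇒≋ (∘ᴺ-as-lin P i Q)) (≋trans (lin-cong (λ w → wordComp-resp w i hQ) P)
      (≋trans (lin-resp _ hP) (≡⇒≋ (sym (∘ᴺ-as-lin P′ i Q′)))))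

  splice-∷ : ∀ {a b} n (v′ : Word a) k (u : Word b) → splice (n ∷ v′) (suc k) u ≡ n ∷ splice v′ k u
  splice-∷ n v′ k u = toList-injective (trans (toList-splice (n ∷ v′) (suc k) u) (cong (n ∷_) (sym (toList-splice v′ k u))))

  splice-unit : ∀ {b} n (u : Word b) → splice (n ∷ []) zero u ≡ u
  splice-unit n u = toList-injective (trans (toList-splice (n ∷ []) zero u) (Listₚ.++-identityʳ (toList u)))

  splice₀-head : ∀ {a b} n m (v′ : Word a) (u : Word b) → splice (n ∷ v′) zero u ≡ splice (m ∷ v′) zero u
  splice₀-head n m v′ u = toList-injective (trans (toList-splice (n ∷ v′) zero u) (sym (toList-splice (m ∷ v′) zero u)))

  Dword-tab : ∀ {a} (u : Word a) → Dword u ≡ List.tabulate (λ k → incrAt k u)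
  Dword-tab u = Listₚ.map-tabulate id (λ k → incrAt k u)

  Dword-cons : ∀ {a} n (v : Word a) → Dword (n ∷ v) ≡ (suc n ∷ v) ∷ List.map (n ∷_) (Dword v)
  Dword-cons n v = begin
      Dword (n ∷ v)
    ≡⟨ Dword-tab (n ∷ v) ⟩
      (suc n ∷ v) ∷ List.tabulate (λ k → n ∷ incrAt k v)
    ≡⟨ cong ((suc n ∷ v) ∷_) (sym (Listₚ.map-tabulate (λ k → incrAt k v) (n ∷_))) ⟩
      (suc n ∷ v) ∷ List.map (n ∷_) (List.tabulate (λ k → incrAt k v))
    ≡⟨ cong (λ ws → (suc n ∷ v) ∷ List.map (n ∷_) ws) (sym (Dword-tab v)) ⟩
      (suc n ∷ v) ∷ List.map (n ∷_) (Dword v) ∎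
    where open ≡.≡-Reasoning

  toList-Dword : ∀ {a} (w : Word a) → List.map toList (Dword w) ≡ derivList (toList w)
  toList-Dword {zero} (n ∷ []) = refl
  toList-Dword {suc a} (n ∷ v) = begin
      List.map toList (Dword (n ∷ v))
    ≡⟨ cong (List.map toList) (Dword-cons n v) ⟩
      (suc n ∷ toList v) ∷ List.map toList (List.map (n ∷_) (Dword v))
    ≡⟨ cong ((suc n ∷ toList v) ∷_) (trans (sym (Listₚ.map-∘ (Dword v))) (Listₚ.map-∘ (Dword v))) ⟩
      (suc n ∷ toList v) ∷ List.map (n ∷_) (List.map toList (Dword v))
    ≡⟨ cong (λ ws → (suc n ∷ toList v) ∷ List.map (n ∷_) ws) (toList-Dword v) ⟩
      derivList (toList (n ∷ v)) ∎
    where open ≡.≡-Reasoning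

  Dword-splice₀ : ∀ {a b} n (v′ : Word a) (r : Word b) →
         Dword (splice (n ∷ v′) zero r) ≡
         List.map (splice (n ∷ v′) zero) (Dword r) ++ List.map (λ u → splice (n ∷ u) zero r) (Dword v′)
  Dword-splice₀ n v′ r = map-toList-injective (begin
      List.map toList (Dword (splice (n ∷ v′) zero r))
    ≡⟨ toList-Dword (splice (n ∷ v′) zero r) ⟩
      derivList (toList (splice (n ∷ v′) zero r))
    ≡⟨ cong derivList (toList-splice (n ∷ v′) zero r) ⟩
      derivList (toList r ++ toList v′)
    ≡⟨ derivList-++ (toList r) (toList v′) ⟩
      List.map (_++ toList v′) (derivList (toList r)) ++ List.map (toList r ++_) (derivList (toList v′))
    ≡⟨ ≡.cong₂ _++_ (cong (List.map (_++ toList v′)) (sym (toList-Dword r)))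
                    (cong (List.map (toList r ++_)) (sym (toList-Dword v′))) ⟩
      List.map (_++ toList v′) (List.map toList (Dword r)) ++ List.map (toList r ++_) (List.map toList (Dword v′))
    ≡⟨ ≡.cong₂ _++_ (trans (sym (Listₚ.map-∘ (Dword r))) (trans (Listₚ.map-cong (λ u → sym (toList-splice (n ∷ v′) zero u)) (Dword r)) (Listₚ.map-∘ (Dword r))))
                    (trans (sym (Listₚ.map-∘ (Dword v′))) (trans (Listₚ.map-cong (λ u → sym (toList-splice (n ∷ u) zero r)) (Dword v′)) (Listₚ.map-∘ (Dword v′)))) ⟩
      List.map toList (List.map (splice (n ∷ v′) zero) (Dword r)) ++ List.map toList (List.map (λ u → splice (n ∷ u) zero r) (Dword v′))
    ≡⟨ sym (Listₚ.map-++ toList (List.map (splice (n ∷ v′) zero) (Dword r)) _) ⟩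
      List.map toList (List.map (splice (n ∷ v′) zero) (Dword r) ++ List.map (λ u → splice (n ∷ u) zero r) (Dword v′)) ∎)
    where open ≡.≡-Reasoning

  D-mapWords : ∀ {a b} (g : Word a → Word b) Y → D (mapWords g Y) ≋ lin (λ u → basisSum (Dword (g u))) Y
  D-mapWords g Y = ≋trans (D-as-lin (mapWords g Y)) (≡⇒≋ (lin-mapWords _ g Y))

  lin-basis : ∀ {a b} (f : Word a → NMI b) w → lin f (basis w) ≋ f w
  lin-basis f w = ≋trans (++idʳ _) (·one (f w))

  D-mapWords-∷ : ∀ {a} n (Y : NMI a) → D (mapWords (n ∷_) Y) ≋ mapWords (suc n ∷_) Y ++ mapWords (n ∷_) (D Y)
  D-mapWords-∷ n Y =
    ≋trans (D-mapWords (n ∷_) Y)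
    (≋trans (lin-cong (λ u → ≡⇒≋ (cong basisSum (Dword-cons n u))) Y)
    (≋trans (lin-+ᶠ (λ u → basis (suc n ∷ u)) (λ u → basisSum (List.map (n ∷_) (Dword u))) Y)
    (++cong (≋sym (mapWords-as-lin (suc n ∷_) Y))
      (≋trans (lin-cong (λ u → ≡⇒≋ (sym (mapWords-basisSum (n ∷_) (Dword u)))) Y)
      (≋trans (≋sym (mapWords-lin (n ∷_) (λ u → basisSum (Dword u)) Y))
       (mapWords-resp (n ∷_) (≋sym (D-as-lin Y))))))))

  wordComp-∷ : ∀ {a b} m (v′ : Word a) k (R : NMI b) → wordComp (m ∷ v′) (suc k) R ≡ mapWords (m ∷_) (wordComp v′ k R)
  wordComp-∷ m v′ k R = trans (mapWords-cong (λ u → splice-∷ m v′ k u) (Dⁿ (lookup v′ k) R)) (sym (mapWords-∘ (m ∷_) (splice v′ k) (Dⁿ (lookup v′ k) R)))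

  D-wordComp : ∀ {a b} (v : Word a) k (R : NMI b) → D (wordComp v k R) ≋ lin (λ v′ → wordComp v′ k R) (basisSum (Dword v))
  D-wordComp {zero} (n ∷ []) zero R =
    ≋trans (≡⇒≋ (cong D (trans (mapWords-cong (splice-unit n) (Dⁿ n R)) (mapWords-id (Dⁿ n R)))))
    (≋trans (≡⇒≋ (sym (trans (mapWords-cong (splice-unit (suc n)) (Dⁿ (suc n) R)) (mapWords-id (Dⁿ (suc n) R)))))
    (≋sym (lin-basis (λ v′ → wordComp v′ zero R) (suc n ∷ []))))
  D-wordComp {suc a} {b} (n ∷ v′) zero R =
    ≋trans (D-mapWords spl X)
    (≋trans (lin-cong (λ r → ≡⇒≋ (trans (cong basisSum (Dword-splice₀ n v′ r)) (basisSum-++ (List.map spl (Dword r)) (List.map (h r) (Dword v′))))) X)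
    (≋trans (lin-+ᶠ (λ r → basisSum (List.map spl (Dword r))) (λ r → basisSum (List.map (h r) (Dword v′))) X)
    (≋trans (++cong first second)
    (≋sym (≋trans (≡⇒≋ (cong (λ Ls → lin f (basisSum Ls)) (Dword-cons n v′)))
           (++cong (≋trans (·one _) (≡⇒≋ (mapWords-cong (λ u → splice₀-head (suc n) n v′ u) (D X))))
                   (≡⇒≋ (lin-basisSum-map f (n ∷_) (Dword v′)))))))))
    where
    X = Dⁿ n R
    spl = splice (n ∷ v′) zero
    h : Word b → Word a → Word (suc a + b)
    h r u = splice (n ∷ u) zero r
    f = λ v″ → wordComp v″ zero R
    first : lin (λ r → basisSum (List.map spl (Dword r))) X ≋ mapWords spl (D X)
    first = ≋trans (lin-cong (λ r → ≡⇒≋ (sym (mapWords-basisSum spl (Dword r)))) X)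
            (≋trans (≋sym (mapWords-lin spl (λ r → basisSum (Dword r)) X)) (mapWords-resp spl (≋sym (D-as-lin X))))
    second : lin (λ r → basisSum (List.map (h r) (Dword v′))) X ≋ lin (λ u → wordComp (n ∷ u) zero R) (basisSum (Dword v′))
    second = ≋trans (lin-cong (λ r → basisSum-map-as-lin (h r) (Dword v′)) X)
             (≋trans (lin-swap (λ r u → basis (h r u)) X (basisSum (Dword v′)))
              (lin-cong (λ u → ≋sym (mapWords-as-lin (λ r → h r u) X)) (basisSum (Dword v′))))
  D-wordComp {suc a} {b} (n ∷ v′) (suc k) R =
    ≋trans (≡⇒≋ (cong D (wordComp-∷ n v′ k R)))
    (≋trans (D-mapWords-∷ n Y)
    (≋trans (++cong ≋refl (≋trans (mapWords-resp (n ∷_) (D-wordComp v′ k R)) (mapWords-lin (n ∷_) (λ u → wordComp u k R) (basisSum (Dword v′)))))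
    (≋sym (≋trans (≡⇒≋ (cong (λ Ls → lin f (basisSum Ls)) (Dword-cons n v′)))
           (++cong (≋trans (·one _) (≡⇒≋ (wordComp-∷ (suc n) v′ k R)))
                   (≋trans (≡⇒≋ (lin-basisSum-map f (n ∷_) (Dword v′))) (lin-cong (λ u → ≡⇒≋ (wordComp-∷ n u k R)) (basisSum (Dword v′)))))))))
    where
    Y = wordComp v′ k R
    f = λ v″ → wordComp v″ (suc k) R

  -- Leibniz rule: D (w ∘ᵢ R) raises a letter of w other than wᵢ, or acts on the inserted
  -- D^{wᵢ} R, which is the same as raising wᵢ itself.
  D-∘ : ∀ {a b} (P : NMI a) k (R : NMI b) → D (P ∘ᴺ[ k ] R) ≋ (D P) ∘ᴺ[ k ] R
  D-∘ P k R =
    ≋trans (≡⇒≋ (cong D (∘ᴺ-as-lin P k R)))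
    (≋trans (D-lin (λ v → wordComp v k R) P)
    (≋trans (lin-cong (λ v → D-wordComp v k R) P)
    (≋sym (≋trans (≡⇒≋ (∘ᴺ-as-lin (D P) k R))
           (≋trans (lin-resp _ (D-as-lin P)) (lin-lin (λ w → basisSum (Dword w)) (λ v → wordComp v k R) P))))))

  Dⁿ-∘ : ∀ {a b} n (P : NMI a) k (R : NMI b) → Dⁿ n (P ∘ᴺ[ k ] R) ≋ (Dⁿ n P) ∘ᴺ[ k ] R
  Dⁿ-∘ zero P k R = ≋refl
  Dⁿ-∘ (suc n) P k R = ≋trans (D-resp (Dⁿ-∘ n P k R)) (D-∘ (Dⁿ n P) k R)

  permute : ∀ {a} → Permutation′ (suc a) → Word a → Word a
  permute σ w = tabulate (λ k → lookup w (σ ⟨$⟩ʳ k))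

  actᴺ-as-mapWords : ∀ {a} (P : NMI a) σ → actᴺ P σ ≡ mapWords (permute σ) P
  actᴺ-as-mapWords P σ = Listₚ.map-cong (λ { (x , w) → refl }) P

  ·ᴺ≡·ᶠ : ∀ {a} x (P : NMI a) → x ·ᴺ P ≡ x ·ᶠ P
  ·ᴺ≡·ᶠ x P = Listₚ.map-cong (λ { (y , w) → refl }) P

  subst-NMI : ∀ {a a′} (e : a ≡ a′) (P : NMI a) → ≡.subst NMI e P ≡ mapWords (≡.subst Word e) P
  subst-NMI refl P = sym (mapWords-id P)

  toList-subst : ∀ {a a′} (e : a ≡ a′) (w : Word a) → toList (≡.subst Word e w) ≡ toList w
  toList-subst refl w = refl

  lookup-splice : ∀ {a b} (w : Word a) i (v : Word b) j → lookup (splice w i v) j ≡ [ lookup w , lookup v ]′ (src i j)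
  lookup-splice w i v j = Vecₚ.lookup∘tabulate (λ j → [ lookup w , lookup v ]′ (src i j)) j

  lookup-splice₂ : ∀ {a b} (w : Word a) i (v : Word b) j k → src i j ≡ inj₂ k → lookup (splice w i v) j ≡ lookup v k
  lookup-splice₂ w i v j k h = trans (lookup-splice w i v j) (cong [ lookup w , lookup v ]′ h)

  lookup-splice₁ : ∀ {a b} (w : Word a) i (v : Word b) j k → src i j ≡ inj₁ k → lookup (splice w i v) j ≡ lookup w k
  lookup-splice₁ w i v j k h = trans (lookup-splice w i v j) (cong [ lookup w , lookup v ]′ h)

  toℕ<length : ∀ {n} (w : Vec ℕ n) (i : Fin n) → toℕ i < length (toList w)
  toℕ<length w i = ≡.subst (toℕ i <_) (sym (Vecₚ.length-toList w)) (Finₚ.toℕ<n i)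

  ·ᴺ-cong : ∀ {a x y} {P Q : NMI a} → x ≈F y → P ≋ Q → x ·ᴺ P ≋ y ·ᴺ Q
  ·ᴺ-cong {x = x} {y} {P} {Q} h h′ = ≋trans (≡⇒≋ (·ᴺ≡·ᶠ x P)) (≋trans (·cong h h′) (≡⇒≋ (sym (·ᴺ≡·ᶠ y Q))))

  actᴺ-resp : ∀ {a} {P Q : NMI a} σ → P ≋ Q → actᴺ P σ ≋ actᴺ Q σ
  actᴺ-resp {P = P} {Q} σ h = ≋trans (≡⇒≋ (actᴺ-as-mapWords P σ)) (≋trans (mapWords-resp (permute σ) h) (≡⇒≋ (sym (actᴺ-as-mapWords Q σ))))

  ·ᴺ-zero : ∀ {a} (P : NMI a) → 0# ·ᴺ P ≋ []
  ·ᴺ-zero P = ≋trans (≡⇒≋ (·ᴺ≡·ᶠ 0# P)) (LinearSpace.·V-zero (nmiSpace _) P)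

  ·ᴺ-one : ∀ {a} (P : NMI a) → 1# ·ᴺ P ≋ P
  ·ᴺ-one P = ≋trans (≡⇒≋ (·ᴺ≡·ᶠ 1# P)) (·one P)

  ·ᴺ-assoc : ∀ {a} x y (P : NMI a) → (x *F y) ·ᴺ P ≋ x ·ᴺ (y ·ᴺ P)
  ·ᴺ-assoc x y P = ≋trans (≡⇒≋ (·ᴺ≡·ᶠ _ P)) (≋trans (LinearSpace.·V-assoc (nmiSpace _) x y P)
                   (≡⇒≋ (sym (trans (·ᴺ≡·ᶠ x _) (cong (x ·ᶠ_) (·ᴺ≡·ᶠ y P))))))

  ·ᴺ-distʳ : ∀ {a} x y (P : NMI a) → (x +F y) ·ᴺ P ≋ x ·ᴺ P ++ y ·ᴺ P
  ·ᴺ-distʳ x y P = ≋trans (≡⇒≋ (·ᴺ≡·ᶠ _ P)) (≋trans (LinearSpace.·V-distʳ (nmiSpace _) x y P)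
                   (≡⇒≋ (sym (≡.cong₂ _++_ (·ᴺ≡·ᶠ x P) (·ᴺ≡·ᶠ y P)))))

  ·ᴺ-distˡ : ∀ {a} x (P Q : NMI a) → x ·ᴺ (P ++ Q) ≋ x ·ᴺ P ++ x ·ᴺ Q
  ·ᴺ-distˡ x P Q = ≋trans (≡⇒≋ (·ᴺ≡·ᶠ x _)) (≋trans (·distˡ x P Q)
                   (≡⇒≋ (sym (≡.cong₂ _++_ (·ᴺ≡·ᶠ x P) (·ᴺ≡·ᶠ x Q)))))

  ∘ᴺ-++ʳ : ∀ {a b} (P : NMI a) i (Q R : NMI b) → P ∘ᴺ[ i ] (Q ++ R) ≋ P ∘ᴺ[ i ] Q ++ P ∘ᴺ[ i ] R
  ∘ᴺ-++ʳ P i Q R =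
    ≋trans (≡⇒≋ (∘ᴺ-as-lin P i _))
    (≋trans (lin-cong (λ w → ≡⇒≋ (trans (cong (mapWords (splice w i)) (Dⁿ-++ (lookup w i) Q R))
                                  (mapWords-++ (splice w i) (Dⁿ (lookup w i) Q) (Dⁿ (lookup w i) R)))) P)
    (≋trans (lin-+ᶠ _ _ P) (≡⇒≋ (sym (≡.cong₂ _++_ (∘ᴺ-as-lin P i Q) (∘ᴺ-as-lin P i R))))))

  ∘ᴺ-·ˡ : ∀ {a b} x (P : NMI a) i (Q : NMI b) → (x ·ᴺ P) ∘ᴺ[ i ] Q ≋ x ·ᴺ (P ∘ᴺ[ i ] Q)
  ∘ᴺ-·ˡ x P i Q =
    ≋trans (≡⇒≋ (trans (cong (_∘ᴺ[ i ] Q) (·ᴺ≡·ᶠ x P)) (∘ᴺ-as-lin (x ·ᶠ P) i Q)))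
    (≋trans (lin-· _ x P) (≡⇒≋ (sym (trans (·ᴺ≡·ᶠ x _) (cong (x ·ᶠ_) (∘ᴺ-as-lin P i Q))))))

  ∘ᴺ-·ʳ : ∀ {a b} x (P : NMI a) i (Q : NMI b) → P ∘ᴺ[ i ] (x ·ᴺ Q) ≋ x ·ᴺ (P ∘ᴺ[ i ] Q)
  ∘ᴺ-·ʳ x P i Q =
    ≋trans (≡⇒≋ (trans (cong (P ∘ᴺ[ i ]_) (·ᴺ≡·ᶠ x Q)) (∘ᴺ-as-lin P i (x ·ᶠ Q))))
    (≋trans (lin-cong (λ w → ≡⇒≋ (trans (cong (mapWords (splice w i)) (Dⁿ-· (lookup w i) x Q))
                                  (mapWords-· (splice w i) x (Dⁿ (lookup w i) Q)))) P)
    (≋trans (lin-·ᶠ x _ P) (≡⇒≋ (sym (trans (·ᴺ≡·ᶠ x _) (cong (x ·ᶠ_) (∘ᴺ-as-lin P i Q)))))))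

  actᴺ-· : ∀ {a} x (P : NMI a) σ → actᴺ (x ·ᴺ P) σ ≋ x ·ᴺ actᴺ P σ
  actᴺ-· x P σ = ≡⇒≋ (trans (actᴺ-as-mapWords _ σ) (trans (cong (mapWords (permute σ)) (·ᴺ≡·ᶠ x P))
                 (trans (mapWords-· (permute σ) x P) (sym (trans (·ᴺ≡·ᶠ x _) (cong (x ·ᶠ_) (actᴺ-as-mapWords P σ)))))))

  seqᴺ : ∀ {a b d} (P : NMI a) (Q : NMI b) (R : NMI d) i j k → src {a} {b} i j ≡ inj₂ k →
         ≡.subst NMI (ℕₚ.+-assoc a b d) ((P ∘ᴺ[ i ] Q) ∘ᴺ[ j ] R) ≋ P ∘ᴺ[ i ] (Q ∘ᴺ[ k ] R)
  seqᴺ {a} {b} {d} P Q R i j k h =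
    ≋trans (≡⇒≋ (trans (subst-NMI e _) (cong (mapWords cw) (trans (∘ᴺ-as-lin (P ∘ᴺ[ i ] Q) j R) (cong (lin (λ u → wordComp u j R)) (∘ᴺ-as-lin P i Q))))))
    (≋trans (mapWords-resp cw (lin-lin (λ w → wordComp w i Q) (λ u → wordComp u j R) P))
    (≋trans (mapWords-lin cw _ P)
    (≋trans (lin-cong on-word P)
    (≡⇒≋ (sym (∘ᴺ-as-lin P i (Q ∘ᴺ[ k ] R)))))))
    where
    e = ℕₚ.+-assoc a b d
    cw = ≡.subst Word e
    word : ∀ (w : Word a) v r → cw (splice (splice w i v) j r) ≡ splice w i (splice v k r)
    word w v r = toList-injective (begin
        toList (cw (splice (splice w i v) j r))
      ≡⟨ toList-subst e _ ⟩
        toList (splice (splice w i v) j r)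
      ≡⟨ toList-splice (splice w i v) j r ⟩
        spliceList (toList (splice w i v)) (toℕ j) (toList r)
      ≡⟨ ≡.cong₂ (λ x y → spliceList x y (toList r)) (toList-splice w i v) (src-inj₂ i j k h) ⟩
        spliceList (spliceList (toList w) (toℕ i) (toList v)) (toℕ i + toℕ k) (toList r)
      ≡⟨ spliceList-seq (toList w) (toℕ i) (toList v) (toℕ k) (toList r) (toℕ<length w i) (toℕ<length v k) ⟩
        spliceList (toList w) (toℕ i) (spliceList (toList v) (toℕ k) (toList r))
      ≡⟨ cong (spliceList (toList w) (toℕ i)) (sym (toList-splice v k r)) ⟩
        spliceList (toList w) (toℕ i) (toList (splice v k r))
      ≡⟨ sym (toList-splice w i (splice v k r)) ⟩
        toList (splice w i (splice v k r)) ∎)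
      where open ≡.≡-Reasoning
    on-word : ∀ w → mapWords cw (lin (λ u → wordComp u j R) (wordComp w i Q)) ≋ wordComp w i (Q ∘ᴺ[ k ] R)
    on-word w =
      ≋trans (≡⇒≋ (cong (mapWords cw) (lin-mapWords (λ u → wordComp u j R) (splice w i) Y)))
      (≋trans (mapWords-lin cw _ Y)
      (≋trans (lin-cong (λ v → ≡⇒≋ (trans (cong (λ n → mapWords cw (mapWords (splice (splice w i v) j) (Dⁿ n R))) (lookup-splice₂ w i v j k h))
                                   (trans (mapWords-∘ cw _ (Dⁿ (lookup v k) R))
                                   (trans (mapWords-cong (word w v) (Dⁿ (lookup v k) R))
                                   (sym (mapWords-∘ (splice w i) (splice v k) (Dⁿ (lookup v k) R))))))) Y)
      (≋sym (≋trans (mapWords-resp (splice w i) (Dⁿ-∘ (lookup w i) Q k R))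
            (≋trans (≡⇒≋ (cong (mapWords (splice w i)) (∘ᴺ-as-lin (Dⁿ (lookup w i) Q) k R)))
             (mapWords-lin (splice w i) (λ v → wordComp v k R) Y))))))
      where Y = Dⁿ (lookup w i) Q

  parᴺ : ∀ {a b d} (P : NMI a) (Q : NMI b) (R : NMI d) i j k j′ →
         src {a} {b} i j ≡ inj₁ k → src {a} {d} k j′ ≡ inj₁ i →
         ≡.subst NMI (trans (ℕₚ.+-assoc a b d) (trans (cong (a +_) (ℕₚ.+-comm b d)) (sym (ℕₚ.+-assoc a d b))))
           ((P ∘ᴺ[ i ] Q) ∘ᴺ[ j ] R) ≋ (P ∘ᴺ[ k ] R) ∘ᴺ[ j′ ] Q
  parᴺ {a} {b} {d} P Q R i j k j′ h₁ h₂ =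
    ≋trans (≡⇒≋ (trans (subst-NMI e _) (cong (mapWords cw) (trans (∘ᴺ-as-lin (P ∘ᴺ[ i ] Q) j R) (cong (lin (λ u → wordComp u j R)) (∘ᴺ-as-lin P i Q))))))
    (≋trans (mapWords-resp cw (lin-lin (λ w → wordComp w i Q) (λ u → wordComp u j R) P))
    (≋trans (mapWords-lin cw _ P)
    (≋trans (lin-cong on-word P)
    (≋sym (≋trans (≡⇒≋ (trans (∘ᴺ-as-lin (P ∘ᴺ[ k ] R) j′ Q) (cong (lin (λ u → wordComp u j′ Q)) (∘ᴺ-as-lin P k R))))
           (lin-lin (λ w → wordComp w k R) (λ u → wordComp u j′ Q) P))))))
    where
    e = trans (ℕₚ.+-assoc a b d) (trans (cong (a +_) (ℕₚ.+-comm b d)) (sym (ℕₚ.+-assoc a d b)))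
    cw = ≡.subst Word e
    word : ∀ (w : Word a) v r → cw (splice (splice w i v) j r) ≡ splice (splice w k r) j′ v
    word w v r = toList-injective (begin
        toList (cw (splice (splice w i v) j r))
      ≡⟨ toList-subst e _ ⟩
        toList (splice (splice w i v) j r)
      ≡⟨ trans (toList-splice (splice w i v) j r) (cong (λ x → spliceList x (toℕ j) (toList r)) (toList-splice w i v)) ⟩
        spliceList (spliceList (toList w) (toℕ i) (toList v)) (toℕ j) (toList r)
      ≡⟨ spliceList-par′ (toList w) (toList v) (toList r) (toℕ i) (toℕ j) (toℕ k) (toℕ j′) b d
           (Vecₚ.length-toList v) (Vecₚ.length-toList r) (toℕ<length w i) (toℕ<length w k) (src-inj₁ i j k h₁) (src-inj₁ k j′ i h₂) ⟩
        spliceList (spliceList (toList w) (toℕ k) (toList r)) (toℕ j′) (toList v)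
      ≡⟨ sym (trans (toList-splice (splice w k r) j′ v) (cong (λ x → spliceList x (toℕ j′) (toList v)) (toList-splice w k r))) ⟩
        toList (splice (splice w k r) j′ v) ∎)
      where open ≡.≡-Reasoning
    on-word : ∀ w → mapWords cw (lin (λ u → wordComp u j R) (wordComp w i Q)) ≋ lin (λ u → wordComp u j′ Q) (wordComp w k R)
    on-word w =
      ≋trans (≡⇒≋ (cong (mapWords cw) (lin-mapWords (λ u → wordComp u j R) (splice w i) Y)))
      (≋trans (mapWords-lin cw _ Y)
      (≋trans (lin-cong (λ v → ≋trans (≡⇒≋ (trans (cong (λ n → mapWords cw (mapWords (splice (splice w i v) j) (Dⁿ n R))) (lookup-splice₁ w i v j k h₁))
                                        (trans (mapWords-∘ cw _ Z) (mapWords-cong (word w v) Z))))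
                                   (mapWords-as-lin _ Z)) Y)
      (≋trans (lin-swap (λ v r → basis (splice (splice w k r) j′ v)) Y Z)
      (≋sym (≋trans (≡⇒≋ (lin-mapWords (λ u → wordComp u j′ Q) (splice w k) Z))
             (lin-cong (λ r → ≋trans (≡⇒≋ (cong (λ n → mapWords (splice (splice w k r) j′) (Dⁿ n Q)) (lookup-splice₁ w k r j′ i h₂)))
                                   (mapWords-as-lin _ Y)) Z))))))
      where Y = Dⁿ (lookup w i) Q
            Z = Dⁿ (lookup w k) R

  unitˡᴺ : ∀ {b} (Q : NMI b) → Iᴺ ∘ᴺ[ zero ] Q ≋ Q
  unitˡᴺ Q = ≋trans (≡⇒≋ (∘ᴺ-as-lin Iᴺ zero Q)) (≋trans (lin-basis (λ w → wordComp w zero Q) (0 ∷ []))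
             (≡⇒≋ (trans (mapWords-cong (splice-unit 0) Q) (mapWords-id Q))))

  Dⁿ-Iᴺ : ∀ n → Dⁿ n Iᴺ ≡ basis (n ∷ [])
  Dⁿ-Iᴺ zero = refl
  Dⁿ-Iᴺ (suc n) = cong D (Dⁿ-Iᴺ n)

  unitʳᴺ : ∀ {a} (P : NMI a) i → ≡.subst NMI (ℕₚ.+-identityʳ a) (P ∘ᴺ[ i ] Iᴺ) ≋ P
  unitʳᴺ {a} P i =
    ≋trans (≡⇒≋ (trans (subst-NMI e _) (cong (mapWords cw) (∘ᴺ-as-lin P i Iᴺ))))
    (≋trans (mapWords-lin cw _ P)
    (≋trans (lin-cong (λ w → ≡⇒≋ (trans (cong (λ X → mapWords cw (mapWords (splice w i) X)) (Dⁿ-Iᴺ (lookup w i)))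
                                  (cong basis (word w)))) P)
    (lin-id P)))
    where
    e = ℕₚ.+-identityʳ a
    cw = ≡.subst Word e
    word : ∀ (w : Word a) → cw (splice w i (lookup w i ∷ [])) ≡ w
    word w = toList-injective (trans (toList-subst e _) (trans (toList-splice w i (lookup w i ∷ []))
             (trans (cong (λ x → spliceList (toList w) (toℕ i) (x ∷ [])) (lookup≡lookupList w i)) (spliceList-unit (toList w) (toℕ i) (toℕ<length w i)))))

  lookup-permute : ∀ {a} (σ : Permutation′ (suc a)) (w : Word a) k → lookup (permute σ w) k ≡ lookup w (σ ⟨$⟩ʳ k)
  lookup-permute σ w k = Vecₚ.lookup∘tabulate (λ k → lookup w (σ ⟨$⟩ʳ k)) k

  equivˡᴺ : ∀ {a b} (P : NMI a) (Q : NMI b) i (σ : Permutation′ (suc a)) (σ′ : Permutation′ (suc (a + b))) →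
            (∀ j → src {a} {b} (σ ⟨$⟩ʳ i) (σ′ ⟨$⟩ʳ j) ≡ map⊎ (σ ⟨$⟩ʳ_) id (src {a} {b} i j)) →
            actᴺ P σ ∘ᴺ[ i ] Q ≋ actᴺ (P ∘ᴺ[ σ ⟨$⟩ʳ i ] Q) σ′
  equivˡᴺ {a} {b} P Q i σ σ′ h =
    ≋trans (≡⇒≋ (trans (∘ᴺ-as-lin (actᴺ P σ) i Q) (trans (cong (lin (λ w → wordComp w i Q)) (actᴺ-as-mapWords P σ)) (lin-mapWords _ (permute σ) P))))
    (≋trans (lin-cong (λ w → ≡⇒≋ (trans (cong (λ n → mapWords (splice (permute σ w) i) (Dⁿ n Q)) (lookup-permute σ w i))
                                (trans (mapWords-cong (word w) _) (sym (mapWords-∘ (permute σ′) (splice w (σ ⟨$⟩ʳ i)) _))))) P)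
    (≋sym (≋trans (≡⇒≋ (trans (actᴺ-as-mapWords _ σ′) (cong (mapWords (permute σ′)) (∘ᴺ-as-lin P (σ ⟨$⟩ʳ i) Q))))
           (mapWords-lin (permute σ′) _ P))))
    where
    word : ∀ (w : Word a) v → splice (permute σ w) i v ≡ permute σ′ (splice w (σ ⟨$⟩ʳ i) v)
    word w v = tabulate-cong (λ j → begin
        [ lookup (permute σ w) , lookup v ] (src i j)
      ≡⟨ Sumₚ.[-,]-cong (lookup-permute σ w) (src i j) ⟩
        [ (λ k → lookup w (σ ⟨$⟩ʳ k)) , lookup v ]′ (src i j)
      ≡⟨ sym (Sumₚ.[,]-map (src i j)) ⟩
        [ lookup w , lookup v ]′ (map⊎ (σ ⟨$⟩ʳ_) id (src i j))
      ≡⟨ cong [ lookup w , lookup v ]′ (sym (h j)) ⟩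
        [ lookup w , lookup v ]′ (src (σ ⟨$⟩ʳ i) (σ′ ⟨$⟩ʳ j))
      ≡⟨ sym (lookup-splice w (σ ⟨$⟩ʳ i) v (σ′ ⟨$⟩ʳ j)) ⟩
        lookup (splice w (σ ⟨$⟩ʳ i) v) (σ′ ⟨$⟩ʳ j) ∎)
      where open ≡.≡-Reasoning

  ++-commutativeMonoid : ℕ → CommutativeMonoid c ℓ
  ++-commutativeMonoid a = record
    { Carrier = NMI a ; _≈_ = _≋_ ; _∙_ = _++_ ; ε = []
    ; isCommutativeMonoid = record
      { isMonoid = record
        { isSemigroup = record
          { isMagma = record { isEquivalence = record { refl = ≋refl ; sym = ≋sym ; trans = ≋trans } ; ∙-cong = ++cong }
          ; assoc = ++assoc }
        ; identity = (λ x → ≋refl) , ++idʳ }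
      ; comm = ++comm } }

  module Sum (a : ℕ) = SumProperties (++-commutativeMonoid a)

  basisSum-tabulate : ∀ {a n} (g : Fin n → Word a) → basisSum (List.tabulate g) ≡ Sum.sum a (λ k → basis (g k))
  basisSum-tabulate {n = zero} g = refl
  basisSum-tabulate {n = suc n} g = cong ((1# , g zero) ∷_) (basisSum-tabulate (g ∘ suc))

  vec-ext : ∀ {n} {x y : Vec ℕ n} → (∀ m → lookup x m ≡ lookup y m) → x ≡ y
  vec-ext {x = x} {y} h = trans (sym (Vecₚ.tabulate∘lookup x)) (trans (tabulate-cong h) (Vecₚ.tabulate∘lookup y))

  lookup-incrAt-same : ∀ {n} (k : Fin n) u → lookup (incrAt k u) k ≡ suc (lookup u k)
  lookup-incrAt-same zero (x ∷ u) = refl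
  lookup-incrAt-same (suc k) (x ∷ u) = lookup-incrAt-same k u

  lookup-incrAt-other : ∀ {n} (k m : Fin n) u → ¬ k ≡ m → lookup (incrAt k u) m ≡ lookup u m
  lookup-incrAt-other zero zero (x ∷ u) ne = ⊥-elim (ne refl)
  lookup-incrAt-other zero (suc m) (x ∷ u) ne = refl
  lookup-incrAt-other (suc k) zero (x ∷ u) ne = refl
  lookup-incrAt-other (suc k) (suc m) (x ∷ u) ne = lookup-incrAt-other k m u (λ e → ne (cong suc e))

  incrAt-permute : ∀ {a} (τ : Permutation′ (suc a)) k (v : Word a) → incrAt k (permute τ v) ≡ permute τ (incrAt (τ ⟨$⟩ʳ k) v)
  incrAt-permute τ k v = vec-ext pointwise
    where
    pointwise : ∀ m → lookup (incrAt k (permute τ v)) m ≡ lookup (permute τ (incrAt (τ ⟨$⟩ʳ k) v)) m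
    pointwise m with k Fin.≟ m
    ... | yes refl = trans (lookup-incrAt-same k (permute τ v))
                     (trans (cong suc (lookup-permute τ v k))
                     (sym (trans (lookup-permute τ (incrAt (τ ⟨$⟩ʳ k) v) k) (lookup-incrAt-same (τ ⟨$⟩ʳ k) v))))
    ... | no ne = trans (lookup-incrAt-other k m (permute τ v) ne)
                  (trans (lookup-permute τ v m)
                  (sym (trans (lookup-permute τ (incrAt (τ ⟨$⟩ʳ k) v) m) (lookup-incrAt-other (τ ⟨$⟩ʳ k) (τ ⟨$⟩ʳ m) v
                        (λ e → ne (trans (sym (inverseˡ τ)) (trans (cong (τ ⟨$⟩ˡ_) e) (inverseˡ τ))))))))

  Dword-permute : ∀ {a} (τ : Permutation′ (suc a)) (v : Word a) →
                basisSum (Dword (permute τ v)) ≋ basisSum (List.map (permute τ) (Dword v))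
  Dword-permute {a} τ v =
    ≋trans (≡⇒≋ (trans (cong basisSum (Dword-tab (permute τ v))) (trans (basisSum-tabulate (λ k → incrAt k (permute τ v)))
                 (Sum.sum-cong-≗ a (λ k → cong basis (incrAt-permute τ k v))))))
    (≋trans (≋sym (Sum.sum-permute a (λ k → basis (permute τ (incrAt k v))) τ))
    (≡⇒≋ (sym (trans (cong basisSum (trans (cong (List.map (permute τ)) (Dword-tab v)) (Listₚ.map-tabulate (λ k → incrAt k v) (permute τ))))
                     (basisSum-tabulate (λ k → permute τ (incrAt k v)))))))

  D-permute : ∀ {a} (τ : Permutation′ (suc a)) (Q : NMI a) → D (mapWords (permute τ) Q) ≋ mapWords (permute τ) (D Q)
  D-permute τ Q =
    ≋trans (D-mapWords (permute τ) Q)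
    (≋trans (lin-cong (Dword-permute τ) Q)
    (≋sym (≋trans (mapWords-resp (permute τ) (D-as-lin Q))
          (≋trans (mapWords-lin (permute τ) _ Q) (lin-cong (λ v → ≡⇒≋ (mapWords-basisSum (permute τ) (Dword v))) Q)))))

  Dⁿ-permute : ∀ {a} n (τ : Permutation′ (suc a)) (Q : NMI a) → Dⁿ n (mapWords (permute τ) Q) ≋ mapWords (permute τ) (Dⁿ n Q)
  Dⁿ-permute zero τ Q = ≋refl
  Dⁿ-permute (suc n) τ Q = ≋trans (D-resp (Dⁿ-permute n τ Q)) (D-permute τ (Dⁿ n Q))

  equivʳᴺ : ∀ {a b} (P : NMI a) (Q : NMI b) i (τ : Permutation′ (suc b)) (τ′ : Permutation′ (suc (a + b))) →
            (∀ j → src {a} {b} i (τ′ ⟨$⟩ʳ j) ≡ map⊎ id (τ ⟨$⟩ʳ_) (src {a} {b} i j)) →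
            P ∘ᴺ[ i ] actᴺ Q τ ≋ actᴺ (P ∘ᴺ[ i ] Q) τ′
  equivʳᴺ {a} {b} P Q i τ τ′ h =
    ≋trans (≡⇒≋ (trans (∘ᴺ-as-lin P i (actᴺ Q τ)) (cong (λ X → lin (λ w → wordComp w i X) P) (actᴺ-as-mapWords Q τ))))
    (≋trans (lin-cong on-word P)
    (≋sym (≋trans (≡⇒≋ (trans (actᴺ-as-mapWords _ τ′) (cong (mapWords (permute τ′)) (∘ᴺ-as-lin P i Q))))
           (mapWords-lin (permute τ′) _ P))))
    where
    word : ∀ (w : Word a) v → splice w i (permute τ v) ≡ permute τ′ (splice w i v)
    word w v = tabulate-cong (λ j → begin
        [ lookup w , lookup (permute τ v) ] (src i j)
      ≡⟨ Sumₚ.[,-]-cong (lookup-permute τ v) (src i j) ⟩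
        [ lookup w , (λ k → lookup v (τ ⟨$⟩ʳ k)) ]′ (src i j)
      ≡⟨ sym (Sumₚ.[,]-map (src i j)) ⟩
        [ lookup w , lookup v ]′ (map⊎ id (τ ⟨$⟩ʳ_) (src i j))
      ≡⟨ cong [ lookup w , lookup v ]′ (sym (h j)) ⟩
        [ lookup w , lookup v ]′ (src i (τ′ ⟨$⟩ʳ j))
      ≡⟨ sym (lookup-splice w i v (τ′ ⟨$⟩ʳ j)) ⟩
        lookup (splice w i v) (τ′ ⟨$⟩ʳ j) ∎)
      where open ≡.≡-Reasoning
    on-word : ∀ w → wordComp w i (mapWords (permute τ) Q) ≋ mapWords (permute τ′) (wordComp w i Q)
    on-word w = ≋trans (mapWords-resp (splice w i) (Dⁿ-permute (lookup w i) τ Q))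
              (≡⇒≋ (trans (mapWords-∘ (splice w i) (permute τ) _)
                   (trans (mapWords-cong (word w) _) (sym (mapWords-∘ (permute τ′) (splice w i) _)))))

  act-idᴺ : ∀ {a} (P : NMI a) (ι : Permutation′ (suc a)) → (∀ j → ι ⟨$⟩ʳ j ≡ j) → actᴺ P ι ≋ P
  act-idᴺ P ι h = ≡⇒≋ (trans (actᴺ-as-mapWords P ι) (trans (mapWords-cong (λ w → vec-ext (λ m → trans (lookup-permute ι w m) (cong (lookup w) (h m)))) P) (mapWords-id P)))

  act-∘ᴺ : ∀ {a} (P : NMI a) (σ τ ρ : Permutation′ (suc a)) → (∀ j → ρ ⟨$⟩ʳ j ≡ σ ⟨$⟩ʳ (τ ⟨$⟩ʳ j)) →
           actᴺ (actᴺ P σ) τ ≋ actᴺ P ρ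
  act-∘ᴺ P σ τ ρ h = ≡⇒≋ (trans (actᴺ-as-mapWords _ τ) (trans (cong (mapWords (permute τ)) (actᴺ-as-mapWords P σ))
    (trans (mapWords-∘ (permute τ) (permute σ) P) (trans (mapWords-cong word P) (sym (actᴺ-as-mapWords P ρ))))))
    where
    word : ∀ w → permute τ (permute σ w) ≡ permute ρ w
    word w = vec-ext (λ m → trans (lookup-permute τ (permute σ w) m) (trans (lookup-permute σ w _) (trans (cong (lookup w) (sym (h m))) (sym (lookup-permute ρ w m)))))

  rel-commᴺ : (τ : Permutation′ 2) → actᴺ X₀X₀ τ ≋ X₀X₀
  rel-commᴺ τ = ≡⇒≋ (trans (actᴺ-as-mapWords X₀X₀ τ) (cong (λ w → (1# , w) ∷ []) (vec-ext (λ m → trans (lookup-permute τ (0 ∷ 0 ∷ []) m) (trans (l0 (τ ⟨$⟩ʳ m)) (sym (l0 m)))))))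
    where
    l0 : ∀ (x : Fin 2) → lookup (0 ∷ 0 ∷ []) x ≡ 0
    l0 zero = refl
    l0 (suc zero) = refl

  rel-assocᴺ : X₀X₀ ∘ᴺ[ zero ] X₀X₀ ≋ X₀X₀ ∘ᴺ[ suc zero ] X₀X₀
  rel-assocᴺ = ≋refl

  rel-leibnizᴺ : X₁ ∘ᴺ[ zero ] X₀X₀ ≋ (X₀X₀ ∘ᴺ[ zero ] X₁) ++ (X₀X₀ ∘ᴺ[ suc zero ] X₁)
  rel-leibnizᴺ = ≋refl

module Interpretation {c ℓ} (F : Field c ℓ) where
  open Over F
  open Field F using () renaming (_≈_ to _≈F_; _+_ to _+F_)
  open NMIOperad F

  θ : ∀ {a} → Term a → NMI a
  θ ∂ⁱ = X₁
  θ mⁱ = X₀X₀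
  θ unit = Iᴺ
  θ (s ∘[ i ] t) = θ s ∘ᴺ[ i ] θ t
  θ (act s σ) = actᴺ (θ s) σ
  θ 𝟘 = []
  θ (s ⊕ t) = θ s ++ θ t
  θ (x · s) = x ·ᴺ θ s

  θ-subst : ∀ {a a′} (e : a ≡ a′) (s : Term a) → θ (≡.subst Term e s) ≡ ≡.subst NMI e (θ s)
  θ-subst refl s = refl

  coeff≡coefficient : ∀ {a} (P : NMI a) w → coeff P w ≡ FS.coefficient a P w
  coeff≡coefficient [] w = refl
  coeff≡coefficient ((x , u) ∷ P) w with ≡-dec ℕ._≟_ u w
  ... | yes _ = cong (x +F_) (coeff≡coefficient P w)
  ... | no _ = coeff≡coefficient P w

  ≋⇒≈ᴺ : ∀ {a} (P Q : NMI a) → P ≋ Q → P ≈ᴺ Q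
  ≋⇒≈ᴺ P Q (FS.mk≈ᶠ h) w = ≡.subst₂ _≈F_ (sym (coeff≡coefficient P w)) (sym (coeff≡coefficient Q w)) (h w)

  ≈ᴺ⇒≋ : ∀ {a} (P Q : NMI a) → P ≈ᴺ Q → P ≋ Q
  ≈ᴺ⇒≋ P Q h = FS.mk≈ᶠ (λ w → ≡.subst₂ _≈F_ (coeff≡coefficient P w) (coeff≡coefficient Q w) (h w))


  θ-resp : ∀ {a} {s t : Term a} → s ≈ t → θ s ≋ θ t
  θ-resp ≈-refl = ≋refl
  θ-resp (≈-sym h) = ≋sym (θ-resp h)
  θ-resp (≈-trans h h′) = ≋trans (θ-resp h) (θ-resp h′)
  θ-resp (∘-cong i h h′) = ∘ᴺ-resp i (θ-resp h) (θ-resp h′)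
  θ-resp (act-cong σ h) = actᴺ-resp σ (θ-resp h)
  θ-resp (⊕-cong h h′) = ++cong (θ-resp h) (θ-resp h′)
  θ-resp (·-cong h h′) = ·ᴺ-cong h (θ-resp h′)
  θ-resp (⊕-assoc s t u) = ++assoc (θ s) (θ t) (θ u)
  θ-resp (⊕-comm s t) = ++comm (θ s) (θ t)
  θ-resp (⊕-idˡ s) = ≋refl
  θ-resp (·-zero s) = ·ᴺ-zero (θ s)
  θ-resp (·-one s) = ·ᴺ-one (θ s)
  θ-resp (·-assoc x y s) = ·ᴺ-assoc x y (θ s)
  θ-resp (·-distʳ x y s) = ·ᴺ-distʳ x y (θ s)
  θ-resp (·-distˡ x s t) = ·ᴺ-distˡ x (θ s) (θ t)
  θ-resp (∘-⊕ˡ s t i u) = ≡⇒≋ (Listₚ.concatMap-++ _ (θ s) (θ t))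
  θ-resp (∘-⊕ʳ s i t u) = ∘ᴺ-++ʳ (θ s) i (θ t) (θ u)
  θ-resp (∘-·ˡ x s i u) = ∘ᴺ-·ˡ x (θ s) i (θ u)
  θ-resp (∘-·ʳ x s i u) = ∘ᴺ-·ʳ x (θ s) i (θ u)
  θ-resp (act-⊕ s t σ) = ≡⇒≋ (Listₚ.map-++ _ (θ s) (θ t))
  θ-resp (act-· x s σ) = actᴺ-· x (θ s) σ
  θ-resp (act-id s ι h) = act-idᴺ (θ s) ι h
  θ-resp (act-∘ s σ τ ρ h) = act-∘ᴺ (θ s) σ τ ρ h
  θ-resp (unitˡ s) = unitˡᴺ (θ s)
  θ-resp (unitʳ {a} s i) = ≋trans (≡⇒≋ (θ-subst (ℕₚ.+-identityʳ a) (s ∘[ i ] unit))) (unitʳᴺ (θ s) i)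
  θ-resp (seq {a} {b} {d} p q r i j k h) =
    ≋trans (≡⇒≋ (θ-subst (ℕₚ.+-assoc a b d) _)) (seqᴺ (θ p) (θ q) (θ r) i j k h)
  θ-resp (par {a} {b} {d} p q r i j k j′ h₁ h₂) =
    ≋trans (≡⇒≋ (θ-subst (trans (ℕₚ.+-assoc a b d) (trans (cong (a +_) (ℕₚ.+-comm b d)) (sym (ℕₚ.+-assoc a d b)))) ((p ∘[ i ] q) ∘[ j ] r))) (parᴺ (θ p) (θ q) (θ r) i j k j′ h₁ h₂)
  θ-resp (equivˡ p q i σ σ′ h) = equivˡᴺ (θ p) (θ q) i σ σ′ h
  θ-resp (equivʳ p q i τ τ′ h) = equivʳᴺ (θ p) (θ q) i τ τ′ h
  θ-resp (rel-comm τ _ _) = rel-commᴺ τ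
  θ-resp rel-assoc = rel-assocᴺ
  θ-resp rel-leibniz = rel-leibnizᴺ

module NormalForm {c ℓ} (F : Field c ℓ) where
  open Over F
  open Field F using (0#)
  open NMIOperad F
  open Splicing F

  termSpace : ℕ → LinearSpace F c (c ⊔ ℓ)
  termSpace a = record { V = Term a ; _≈V_ = _≈_ ; 0V = 𝟘 ; _+V_ = _⊕_ ; _·V_ = _·_
    ; reflV = ≈-refl ; symV = ≈-sym ; transV = ≈-trans ; +V-cong = ⊕-cong ; ·V-cong = ·-cong
    ; +V-assoc = ⊕-assoc ; +V-comm = ⊕-comm ; +V-idˡ = ⊕-idˡ ; ·V-zero = ·-zero ; ·V-one = ·-one
    ; ·V-assoc = ·-assoc ; ·V-distʳ = ·-distʳ ; ·V-distˡ = ·-distˡ }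

  termSetoid : ℕ → Setoid c (c ⊔ ℓ)
  termSetoid a = LinearSpaceProperties.≈V-setoid (termSpace a)

  ≡⇒≈ : ∀ {a} {s t : Term a} → s ≡ t → s ≈ t
  ≡⇒≈ refl = ≈-refl

  ∂ⁿ : ℕ → Term 0
  ∂ⁿ zero = unit
  ∂ⁿ (suc n) = ∂ⁱ ∘[ zero ] ∂ⁿ n

  m∂ⁿ : ℕ → Term 1
  m∂ⁿ n = mⁱ ∘[ zero ] ∂ⁿ n

  -- monomial (n₁ ∷ n₂ ∷ ⋯) = ∂^{n₁}x₁ · (∂^{n₂}x₂ · ⋯), the preimage of X_{n₁} X_{n₂} ⋯.
  monomial : ∀ {a} → Word a → Term a
  monomial {zero} (n ∷ []) = ∂ⁿ n
  monomial {suc a} (n ∷ v) = m∂ⁿ n ∘[ suc zero ] monomial v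

  linᵀ : ∀ {a b} → (Word a → Term b) → NMI a → Term b
  linᵀ {a} {b} = FS.extend a (termSpace b)

  ψ : ∀ {a} → NMI a → Term a
  ψ = linᵀ monomial

  linᵀ-cong : ∀ {a b} {f g : Word a → Term b} → (∀ w → f w ≈ g w) → ∀ P → linᵀ f P ≈ linᵀ g P
  linᵀ-cong {a} {b} = FS.extend-cong a (termSpace b)

  linᵀ-resp : ∀ {a b} (f : Word a → Term b) {P Q} → P ≋ Q → linᵀ f P ≈ linᵀ f Q
  linᵀ-resp {a} {b} f = FS.extend-resp a (termSpace b) f

  ψ-lin : ∀ {a b} (f : Word a → NMI b) P → ψ (lin f P) ≈ linᵀ (ψ ∘ f) P
  ψ-lin {a} {b} f P = FS₂.extend-extend a b (termSpace b) f monomial P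

  ψ-basis : ∀ {a} (w : Word a) → ψ (basis w) ≈ monomial w
  ψ-basis w = ≈-trans (⊕-cong ≈-refl (≈-refl {s = 𝟘})) (≈-trans (LinearSpaceProperties.+V-idʳ (termSpace _) _) (·-one (monomial w)))

  ψ-mapWords : ∀ {a b} (f : Word a → Word b) P → ψ (mapWords f P) ≈ linᵀ (monomial ∘ f) P
  ψ-mapWords f P = ≈-trans (linᵀ-resp monomial (mapWords-as-lin f P)) (≈-trans (ψ-lin (λ w → basis (f w)) P) (linᵀ-cong (λ w → ψ-basis (f w)) P))

  linᵀ-basisSum-map : ∀ {a b d} (f : Word b → Term d) (g : Word a → Word b) (Ls : List (Word a)) →
               linᵀ f (basisSum (List.map g Ls)) ≡ linᵀ (f ∘ g) (basisSum Ls)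
  linᵀ-basisSum-map f g [] = refl
  linᵀ-basisSum-map f g (w ∷ Ls) = cong (_ ⊕_) (linᵀ-basisSum-map f g Ls)

  ∘𝟘 : ∀ {a b} (s : Term a) i → s ∘[ i ] (𝟘 {b}) ≈ 𝟘
  ∘𝟘 s i = ≈-trans (∘-cong i ≈-refl (≈-sym (·-zero 𝟘))) (≈-trans (∘-·ʳ 0# s i 𝟘) (·-zero _))

  𝟘∘ : ∀ {a b} i (t : Term b) → (𝟘 {a}) ∘[ i ] t ≈ 𝟘
  𝟘∘ i t = ≈-trans (∘-cong i (≈-sym (·-zero 𝟘)) ≈-refl) (≈-trans (∘-·ˡ 0# 𝟘 i t) (·-zero _))

  act𝟘 : ∀ {a} σ → act (𝟘 {a}) σ ≈ 𝟘
  act𝟘 σ = ≈-trans (act-cong σ (≈-sym (·-zero 𝟘))) (≈-trans (act-· 0# 𝟘 σ) (·-zero _))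

  ∘-linᵀʳ : ∀ {a b d} (s : Term a) i (f : Word d → Term b) P → s ∘[ i ] linᵀ f P ≈ linᵀ (λ w → s ∘[ i ] f w) P
  ∘-linᵀʳ {a} {b} {d} s i = LinearMap.extend-linear F _≟ʷ_ (termSpace b) (termSpace (a + b)) (s ∘[ i ]_) (∘-⊕ʳ s i) (λ x t → ∘-·ʳ x s i t) (∘𝟘 s i)

  ∘-linᵀˡ : ∀ {a b d} i (t : Term b) (f : Word d → Term a) P → linᵀ f P ∘[ i ] t ≈ linᵀ (λ w → f w ∘[ i ] t) P
  ∘-linᵀˡ {a} {b} {d} i t = LinearMap.extend-linear F _≟ʷ_ (termSpace a) (termSpace (a + b)) (_∘[ i ] t) (λ s s′ → ∘-⊕ˡ s s′ i t) (λ x s → ∘-·ˡ x s i t) (𝟘∘ i t)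

  act-linᵀ : ∀ {a d} σ (f : Word d → Term a) P → act (linᵀ f P) σ ≈ linᵀ (λ w → act (f w) σ) P
  act-linᵀ {a} {d} σ = LinearMap.extend-linear F _≟ʷ_ (termSpace a) (termSpace a) (λ s → act s σ) (λ s t → act-⊕ s t σ) (λ x s → act-· x s σ) (act𝟘 σ)

  subst-≈ : ∀ {a a′} (e : a ≡ a′) {s t : Term a} → s ≈ t → ≡.subst Term e s ≈ ≡.subst Term e t
  subst-≈ refl h = h

  subst-linᵀ : ∀ {a b b′} (e : b ≡ b′) (f : Word a → Term b) P → ≡.subst Term e (linᵀ f P) ≡ linᵀ (λ w → ≡.subst Term e (f w)) P
  subst-linᵀ refl f P = refl

  subst-monomial : ∀ {a a′} (e : a ≡ a′) (w : Word a) → ≡.subst Term e (monomial w) ≡ monomial (≡.subst Word e w)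
  subst-monomial refl w = refl

  ∂∘monomial : ∀ {a} (v : Word a) → ∂ⁱ ∘[ zero ] monomial v ≈ ψ (basisSum (Dword v))
  ∂∘monomial {zero} (n ∷ []) = ≈-sym (ψ-basis (suc n ∷ []))
  ∂∘monomial {suc a} (n ∷ v′) = begin
      ∂ⁱ ∘[ zero ] (m∂ⁿ n ∘[ suc zero ] monomial v′)
    ≈⟨ ≈-sym (seq ∂ⁱ (m∂ⁿ n) (monomial v′) zero (suc zero) (suc zero) refl) ⟩
      (∂ⁱ ∘[ zero ] m∂ⁿ n) ∘[ suc zero ] monomial v′
    ≈⟨ ∘-cong (suc zero) step ≈-refl ⟩
      (m∂ⁿ (suc n) ⊕ (m∂ⁿ n ∘[ suc zero ] ∂ⁱ)) ∘[ suc zero ] monomial v′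
    ≈⟨ ∘-⊕ˡ _ _ (suc zero) (monomial v′) ⟩
      monomial (suc n ∷ v′) ⊕ (m∂ⁿ n ∘[ suc zero ] ∂ⁱ) ∘[ suc zero ] monomial v′
    ≈⟨ ⊕-cong ≈-refl (seq (m∂ⁿ n) ∂ⁱ (monomial v′) (suc zero) (suc zero) zero refl) ⟩
      monomial (suc n ∷ v′) ⊕ m∂ⁿ n ∘[ suc zero ] (∂ⁱ ∘[ zero ] monomial v′)
    ≈⟨ ⊕-cong ≈-refl (∘-cong (suc zero) ≈-refl (∂∘monomial v′)) ⟩
      monomial (suc n ∷ v′) ⊕ m∂ⁿ n ∘[ suc zero ] ψ (basisSum (Dword v′))
    ≈⟨ ⊕-cong ≈-refl (∘-linᵀʳ (m∂ⁿ n) (suc zero) monomial (basisSum (Dword v′))) ⟩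
      monomial (suc n ∷ v′) ⊕ linᵀ (λ u → monomial (n ∷ u)) (basisSum (Dword v′))
    ≈⟨ ⊕-cong (≈-sym (·-one _)) (≡⇒≈ (sym (linᵀ-basisSum-map monomial (n ∷_) (Dword v′)))) ⟩
      ψ (basisSum ((suc n ∷ v′) ∷ List.map (n ∷_) (Dword v′)))
    ≈⟨ ≡⇒≈ (cong (λ Ls → ψ (basisSum Ls)) (sym (Dword-cons n v′))) ⟩
      ψ (basisSum (Dword (n ∷ v′))) ∎
    where
    open import Relation.Binary.Reasoning.Setoid (termSetoid (suc a))
    step : ∂ⁱ ∘[ zero ] m∂ⁿ n ≈ m∂ⁿ (suc n) ⊕ (m∂ⁿ n ∘[ suc zero ] ∂ⁱ)
    step = ≈-trans (≈-sym (seq ∂ⁱ mⁱ (∂ⁿ n) zero zero zero refl))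
           (≈-trans (∘-cong zero rel-leibniz ≈-refl)
           (≈-trans (∘-⊕ˡ _ _ zero (∂ⁿ n))
           (⊕-cong (seq mⁱ ∂ⁱ (∂ⁿ n) zero zero zero refl)
                   (par mⁱ ∂ⁱ (∂ⁿ n) (suc zero) zero zero (suc zero) refl refl))))

  ∂∘ψ : ∀ {a} (Q : NMI a) → ∂ⁱ ∘[ zero ] ψ Q ≈ ψ (D Q)
  ∂∘ψ Q = ≈-trans (∘-linᵀʳ ∂ⁱ zero monomial Q) (≈-trans (linᵀ-cong ∂∘monomial Q)
         (≈-trans (≈-sym (ψ-lin (λ w → basisSum (Dword w)) Q)) (linᵀ-resp monomial (≋sym (D-as-lin Q)))))

  ∂ⁿ∘ψ : ∀ {a} n (Q : NMI a) → ∂ⁿ n ∘[ zero ] ψ Q ≈ ψ (Dⁿ n Q)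
  ∂ⁿ∘ψ zero Q = unitˡ (ψ Q)
  ∂ⁿ∘ψ (suc n) Q = ≈-trans (seq ∂ⁱ (∂ⁿ n) (ψ Q) zero zero zero refl)
                  (≈-trans (∘-cong zero ≈-refl (∂ⁿ∘ψ n Q)) (∂∘ψ (Dⁿ n Q)))

  src₀-unary : ∀ b (j : Fin (suc b)) → src₀ 0 b j ≡ inj₂ j
  src₀-unary zero zero = refl
  src₀-unary (suc b) zero = refl
  src₀-unary (suc b) (suc j) = trans (cong (map⊎ id suc) (trans (cong (src₀ 0 b) (Finₚ.cast-is-id refl j)) (src₀-unary b j))) refl

  lastInput : ∀ b → Fin (suc (1 + b))
  lastInput zero = suc zero
  lastInput (suc b) = suc (lastInput b)

  src₀-last : ∀ b → src₀ 1 b (lastInput b) ≡ inj₁ (suc zero)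
  src₀-last zero = refl
  src₀-last (suc b) = cong (map⊎ id suc) (trans (cong (src₀ 1 b) (Finₚ.cast-is-id refl (lastInput b))) (src₀-last b))

  infixr 5 _++ʷ_
  _++ʷ_ : ∀ {b d} → Word b → Word d → Word (suc (b + d))
  _++ʷ_ {zero} (k ∷ []) v = k ∷ v
  _++ʷ_ {suc b} (k ∷ u′) v = k ∷ (u′ ++ʷ v)

  toList-++ʷ : ∀ {b d} (u : Word b) (v : Word d) → toList (u ++ʷ v) ≡ toList u ++ toList v
  toList-++ʷ {zero} (k ∷ []) v = refl
  toList-++ʷ {suc b} (k ∷ u′) v = cong (k ∷_) (toList-++ʷ u′ v)

  monomial-++ʷ : ∀ {b d} (u : Word b) (v : Word d) → (mⁱ ∘[ zero ] monomial u) ∘[ lastInput b ] monomial v ≈ monomial (u ++ʷ v)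
  monomial-++ʷ {zero} (k ∷ []) v = ≈-refl
  monomial-++ʷ {suc b} (k ∷ u′) v =
    ≈-trans (∘-cong (lastInput (suc b)) step ≈-refl)
    (≈-trans (seq (m∂ⁿ k) (mⁱ ∘[ zero ] monomial u′) (monomial v) (suc zero) (suc (lastInput b)) (lastInput b)
                  (cong (map⊎ suc id) (src₀-unary (suc b) (lastInput b))))
    (∘-cong (suc zero) ≈-refl (monomial-++ʷ u′ v)))
    where
    step : mⁱ ∘[ zero ] monomial (k ∷ u′) ≈ m∂ⁿ k ∘[ suc zero ] (mⁱ ∘[ zero ] monomial u′)
    step = ≈-trans (≈-sym (seq mⁱ (m∂ⁿ k) (monomial u′) zero (suc zero) (suc zero) refl))
           (≈-trans (∘-cong (suc zero)
              (≈-trans (≈-sym (seq mⁱ mⁱ (∂ⁿ k) zero zero zero refl))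
              (≈-trans (∘-cong zero rel-assoc ≈-refl)
              (par mⁱ mⁱ (∂ⁿ k) (suc zero) zero zero (suc zero) refl refl))) ≈-refl)
           (seq (m∂ⁿ k) mⁱ (monomial u′) (suc zero) (suc zero) zero refl))

  monomial∘ψ : ∀ {a b} (w : Word a) i (Q : NMI b) → monomial w ∘[ i ] ψ Q ≈ ψ (wordComp w i Q)
  monomial∘ψ {zero} (n ∷ []) zero Q = ≈-trans (∂ⁿ∘ψ n Q) (≡⇒≈ (cong ψ (sym (trans (mapWords-cong (splice-unit n) (Dⁿ n Q)) (mapWords-id (Dⁿ n Q))))))
  monomial∘ψ {suc a} (n ∷ v′) (suc i) Q =
    ≈-trans (seq (m∂ⁿ n) (monomial v′) (ψ Q) (suc zero) (suc i) i (cong (map⊎ suc id) (src₀-unary a i)))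
    (≈-trans (∘-cong (suc zero) ≈-refl (monomial∘ψ v′ i Q))
    (≈-trans (∘-linᵀʳ (m∂ⁿ n) (suc zero) monomial (wordComp v′ i Q))
    (≈-trans (≈-sym (ψ-mapWords (n ∷_) (wordComp v′ i Q)))
    (≡⇒≈ (cong ψ (sym (wordComp-∷ n v′ i Q)))))))
  monomial∘ψ {suc a} {b} (n ∷ v′) zero Q =
    ≈-trans (≡⇒≈ (sym (subst-sym-subst e)))
    (≈-trans (subst-≈ (sym e) h)
    (≈-trans (≡⇒≈ (subst-linᵀ (sym e) (λ u → monomial (u ++ʷ v′)) Y))
    (≈-trans (linᵀ-cong (λ u → ≡⇒≈ (trans (subst-monomial (sym e) (u ++ʷ v′)) (cong monomial (word u)))) Y)
    (≈-sym (ψ-mapWords (splice (n ∷ v′) zero) Y)))))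
    where
    e = trans (ℕₚ.+-assoc 1 a b) (trans (cong (1 +_) (ℕₚ.+-comm a b)) (sym (ℕₚ.+-assoc 1 b a)))
    Y = Dⁿ n Q
    h : ≡.subst Term e ((m∂ⁿ n ∘[ suc zero ] monomial v′) ∘[ zero ] ψ Q) ≈ linᵀ (λ u → monomial (u ++ʷ v′)) Y
    h = ≈-trans (par (m∂ⁿ n) (monomial v′) (ψ Q) (suc zero) zero zero (lastInput b) refl (src₀-last b))
        (≈-trans (∘-cong (lastInput b) (≈-trans (seq mⁱ (∂ⁿ n) (ψ Q) zero zero zero refl)
                                   (≈-trans (∘-cong zero ≈-refl (∂ⁿ∘ψ n Q)) (∘-linᵀʳ mⁱ zero monomial Y))) ≈-refl)
        (≈-trans (∘-linᵀˡ (lastInput b) (monomial v′) (λ u → mⁱ ∘[ zero ] monomial u) Y)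
        (linᵀ-cong (λ u → monomial-++ʷ u v′) Y)))
    word : ∀ u → ≡.subst Word (sym e) (u ++ʷ v′) ≡ splice (n ∷ v′) zero u
    word u = toList-injective (trans (toList-subst (sym e) (u ++ʷ v′)) (trans (toList-++ʷ u v′) (sym (toList-splice (n ∷ v′) zero u))))

  ψ-∘ : ∀ {a b} (P : NMI a) i (Q : NMI b) → ψ (P ∘ᴺ[ i ] Q) ≈ ψ P ∘[ i ] ψ Q
  ψ-∘ P i Q = ≈-trans (≡⇒≈ (cong ψ (∘ᴺ-as-lin P i Q))) (≈-trans (ψ-lin (λ w → wordComp w i Q) P)
              (≈-trans (linᵀ-cong (λ w → ≈-sym (monomial∘ψ w i Q)) P) (≈-sym (∘-linᵀˡ i (ψ Q) monomial P))))

  swap01 : ∀ {n} → Fin (suc (suc n)) → Fin (suc (suc n))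
  swap01 zero = suc zero
  swap01 (suc zero) = zero
  swap01 (suc (suc k)) = suc (suc k)

  swap01-involutive : ∀ {n} (x : Fin (suc (suc n))) → swap01 (swap01 x) ≡ x
  swap01-involutive zero = refl
  swap01-involutive (suc zero) = refl
  swap01-involutive (suc (suc k)) = refl

  swap₀₁ : ∀ {n} → Permutation′ (suc (suc n))
  swap₀₁ = Perm.permutation swap01 swap01 swap01-involutive swap01-involutive

  permute-∘ : ∀ {a} (σ τ ρ : Permutation′ (suc a)) → (∀ j → ρ ⟨$⟩ʳ j ≡ σ ⟨$⟩ʳ (τ ⟨$⟩ʳ j)) →
              ∀ (w : Word a) → permute τ (permute σ w) ≡ permute ρ w
  permute-∘ σ τ ρ h w = vec-ext (λ m → trans (lookup-permute τ (permute σ w) m) (trans (lookup-permute σ w _)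
                        (trans (cong (lookup w) (sym (h m))) (sym (lookup-permute ρ w m)))))

  act-ext : ∀ {a} (s : Term a) (σ σ′ : Permutation′ (suc a)) → (∀ j → σ ⟨$⟩ʳ j ≡ σ′ ⟨$⟩ʳ j) → act s σ ≈ act s σ′
  act-ext s σ σ′ h = ≈-trans (≈-sym (act-id (act s σ) Perm.id (λ j → refl))) (act-∘ s σ Perm.id σ′ (λ j → sym (h j)))

  monomial-swap₂ : ∀ n k → monomial (n ∷ k ∷ []) ≈ act (monomial (k ∷ n ∷ [])) swap₀₁
  monomial-swap₂ n k =
    ≈-trans (∘-cong (suc zero) (∘-cong zero (≈-sym (rel-comm swap₀₁ refl refl)) ≈-refl) ≈-refl)
    (≈-trans (∘-cong (suc zero) (equivˡ mⁱ (∂ⁿ n) zero swap₀₁ swap₀₁ h₁) ≈-refl)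
    (≈-trans (equivˡ (mⁱ ∘[ suc zero ] ∂ⁿ n) (∂ⁿ k) (suc zero) swap₀₁ swap₀₁ h₂)
    (act-cong swap₀₁ (par mⁱ (∂ⁿ n) (∂ⁿ k) (suc zero) zero zero (suc zero) refl refl))))
    where
    h₁ : ∀ j → src {1} {0} (swap₀₁ ⟨$⟩ʳ zero) (swap₀₁ ⟨$⟩ʳ j) ≡ map⊎ (swap₀₁ ⟨$⟩ʳ_) id (src {1} {0} zero j)
    h₁ zero = refl
    h₁ (suc zero) = refl
    h₂ : ∀ j → src {1} {0} (swap₀₁ ⟨$⟩ʳ suc zero) (swap₀₁ ⟨$⟩ʳ j) ≡ map⊎ (swap₀₁ ⟨$⟩ʳ_) id (src {1} {0} (suc zero) j)
    h₂ zero = refl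
    h₂ (suc zero) = refl

  monomial-swap : ∀ {a} n k (v : Vec ℕ a) → monomial {suc a} (n ∷ k ∷ v) ≈ act (monomial (k ∷ n ∷ v)) swap₀₁
  monomial-swap {zero} n k [] = monomial-swap₂ n k
  monomial-swap {suc a} n k v =
    ≈-trans (≈-sym (monomial-++ʷ (n ∷ k ∷ []) v))
    (≈-trans (∘-cong (lastInput 1) (∘-cong zero ≈-refl (monomial-swap₂ n k)) ≈-refl)
    (≈-trans (∘-cong (lastInput 1) (equivʳ mⁱ (monomial (k ∷ n ∷ [])) zero swap₀₁ swap₀₁ h₃) ≈-refl)
    (≈-trans (equivˡ (mⁱ ∘[ zero ] monomial (k ∷ n ∷ [])) (monomial v) (lastInput 1) swap₀₁ swap₀₁ h₄)
    (act-cong swap₀₁ (monomial-++ʷ (k ∷ n ∷ []) v)))))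
    where
    h₃ : ∀ j → src {1} {1} zero (swap₀₁ ⟨$⟩ʳ j) ≡ map⊎ id (swap₀₁ ⟨$⟩ʳ_) (src {1} {1} zero j)
    h₃ zero = refl
    h₃ (suc zero) = refl
    h₃ (suc (suc zero)) = refl
    h₄ : ∀ j → src {2} {a} (swap₀₁ ⟨$⟩ʳ lastInput 1) (swap₀₁ ⟨$⟩ʳ j) ≡ map⊎ (swap₀₁ ⟨$⟩ʳ_) id (src {2} {a} (lastInput 1) j)
    h₄ zero = refl
    h₄ (suc zero) = refl
    h₄ (suc (suc j)) = trans (cong (map⊎ suc id ∘ map⊎ suc id) (src₀-unary a j))
                        (sym (cong (map⊎ (swap₀₁ ⟨$⟩ʳ_) id ∘ map⊎ suc id ∘ map⊎ suc id) (src₀-unary a j)))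

  act-swap-monomial : ∀ {a} (w : Word (suc a)) → act (monomial w) swap₀₁ ≈ monomial (permute swap₀₁ w)
  act-swap-monomial {a} (n ∷ k ∷ v) =
    ≈-trans (act-cong swap₀₁ (monomial-swap n k v))
    (≈-trans (act-∘ (monomial (k ∷ n ∷ v)) swap₀₁ swap₀₁ Perm.id (λ j → sym (swap01-involutive j)))
    (≈-trans (act-id _ Perm.id (λ j → refl))
    (≡⇒≈ (cong monomial (cong (λ x → k ∷ n ∷ x) (sym (Vecₚ.tabulate∘lookup v)))))))

  act-lift₀-monomial : ∀ {a} → (∀ (u : Word a) τ → act (monomial u) τ ≈ monomial (permute τ u)) →
          ∀ (w : Word (suc a)) β → act (monomial w) (Perm.lift₀ β) ≈ monomial (permute (Perm.lift₀ β) w)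
  act-lift₀-monomial {a} IH (n ∷ v) β =
    ≈-trans (≈-sym (equivʳ (m∂ⁿ n) (monomial v) (suc zero) β (Perm.lift₀ β) h))
    (∘-cong (suc zero) ≈-refl (IH v β))
    where
    h : ∀ j → src {1} {a} (suc zero) (Perm.lift₀ β ⟨$⟩ʳ j) ≡ map⊎ id (β ⟨$⟩ʳ_) (src {1} {a} (suc zero) j)
    h zero = refl
    h (suc j) = trans (cong (map⊎ suc id) (src₀-unary a (β ⟨$⟩ʳ j))) (sym (cong (map⊎ id (β ⟨$⟩ʳ_) ∘ map⊎ suc id) (src₀-unary a j)))

  -- If σ(0) = suc p then σ = ζ ∘ lift₀ π′ as maps, where ζ = swap₀₁ ∘ₚ lift₀ (transpose 0 p)
  -- also sends 0 to suc p.  The swap is handled by commutativity of m, and each lift₀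
  -- acts on the tail of the monomial by equivariance.
  act-monomial : ∀ {a} (w : Word a) σ → act (monomial w) σ ≈ monomial (permute σ w)
  act-monomial {zero} (n ∷ []) σ = ≈-trans (act-id _ σ h) (≡⇒≈ (cong monomial (sym (vec-ext {x = permute σ (n ∷ [])} {y = n ∷ []} (λ { zero → trans (lookup-permute σ (n ∷ []) zero) (l (σ ⟨$⟩ʳ zero)) })))))
    where
    h : ∀ j → σ ⟨$⟩ʳ j ≡ j
    h zero with σ ⟨$⟩ʳ zero
    ... | zero = refl
    l : ∀ (x : Fin 1) → lookup (n ∷ []) x ≡ n
    l zero = refl
  act-monomial {suc a} w σ = by-image-of-zero (σ ⟨$⟩ʳ zero) refl
    where
    by-image-of-zero : ∀ x → σ ⟨$⟩ʳ zero ≡ x → act (monomial w) σ ≈ monomial (permute σ w)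
    by-image-of-zero zero eq =
      ≈-trans (act-ext (monomial w) σ (Perm.lift₀ π′) (λ j → sym (Perm.lift₀-remove σ eq j)))
      (≈-trans (act-lift₀-monomial act-monomial w π′)
      (≡⇒≈ (cong monomial (vec-ext {x = permute (Perm.lift₀ π′) w} {y = permute σ w} (λ m → trans (lookup-permute (Perm.lift₀ π′) w m) (trans (cong (lookup w) (Perm.lift₀-remove σ eq m)) (sym (lookup-permute σ w m))))))))
        where π′ = Perm.remove zero σ
    by-image-of-zero (suc p) eq =
      ≈-trans (≈-sym (act-∘ (monomial w) ζ (Perm.lift₀ π′) σ hσ))
      (≈-trans (act-cong (Perm.lift₀ π′) (≈-sym (act-∘ (monomial w) (Perm.lift₀ α) swap₀₁ ζ (λ j → refl))))
      (≈-trans (act-cong (Perm.lift₀ π′) (act-cong swap₀₁ (act-lift₀-monomial act-monomial w α)))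
      (≈-trans (act-cong (Perm.lift₀ π′) (act-swap-monomial (permute (Perm.lift₀ α) w)))
      (≈-trans (act-lift₀-monomial act-monomial (permute swap₀₁ (permute (Perm.lift₀ α) w)) π′)
      (≡⇒≈ (cong monomial (trans (cong (permute (Perm.lift₀ π′)) (permute-∘ (Perm.lift₀ α) swap₀₁ ζ (λ j → refl) w))
                   (permute-∘ ζ (Perm.lift₀ π′) σ hσ w))))))))
      where
      α : Permutation′ (suc a)
      α = Perm.transpose zero p
      α0 : α ⟨$⟩ʳ zero ≡ p
      α0 = refl
      ζ : Permutation′ (suc (suc a))
      ζ = swap₀₁ Perm.∘ₚ Perm.lift₀ α
      π : Permutation′ (suc (suc a))
      π = σ Perm.∘ₚ Perm.flip ζ
      π0 : π ⟨$⟩ʳ zero ≡ zero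
      π0 = trans (cong (ζ ⟨$⟩ˡ_) (trans eq (cong suc (sym α0)))) (Perm.inverseˡ ζ)
      π′ = Perm.remove zero π
      hσ : ∀ j → σ ⟨$⟩ʳ j ≡ ζ ⟨$⟩ʳ (Perm.lift₀ π′ ⟨$⟩ʳ j)
      hσ j = trans (sym (Perm.inverseʳ ζ)) (cong (ζ ⟨$⟩ʳ_) (sym (Perm.lift₀-remove π π0 j)))

module Isomorphism {c ℓ} (F : Field c ℓ) where
  open Over F
  open Field F using (0#)
  private module 𝔽 = Field F
  open NMIOperad F
  open Splicing F
  open NormalForm F
  open Interpretation F using (θ; ≋⇒≈ᴺ; ≈ᴺ⇒≋; θ-resp)

  ψ-act : ∀ {a} (P : NMI a) σ → ψ (actᴺ P σ) ≈ act (ψ P) σ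
  ψ-act P σ = ≈-trans (≡⇒≈ (cong ψ (actᴺ-as-mapWords P σ))) (≈-trans (ψ-mapWords (permute σ) P)
              (≈-trans (linᵀ-cong (λ w → ≈-sym (act-monomial w σ)) P) (≈-sym (act-linᵀ σ monomial P))))

  ψ∘θ : ∀ {a} (s : Term a) → ψ (θ s) ≈ s
  ψ∘θ ∂ⁱ = ≈-trans (ψ-basis (1 ∷ [])) (unitʳ ∂ⁱ zero)
  ψ∘θ mⁱ = ≈-trans (ψ-basis (0 ∷ 0 ∷ [])) (≈-trans (∘-cong (suc zero) (unitʳ mⁱ zero) ≈-refl) (unitʳ mⁱ (suc zero)))
  ψ∘θ unit = ψ-basis (0 ∷ [])
  ψ∘θ (s ∘[ i ] t) = ≈-trans (ψ-∘ (θ s) i (θ t)) (∘-cong i (ψ∘θ s) (ψ∘θ t))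
  ψ∘θ (act s σ) = ≈-trans (ψ-act (θ s) σ) (act-cong σ (ψ∘θ s))
  ψ∘θ 𝟘 = ≈-refl
  ψ∘θ {a} (s ⊕ t) = ≈-trans (FS.extend-++ a (termSpace a) monomial (θ s) (θ t)) (⊕-cong (ψ∘θ s) (ψ∘θ t))
  ψ∘θ {a} (x · s) = ≈-trans (≡⇒≈ (cong ψ (·ᴺ≡·ᶠ x (θ s)))) (≈-trans (FS.extend-· a (termSpace a) monomial x (θ s)) (·-cong 𝔽.refl (ψ∘θ s)))

  basis-∘ᴺ : ∀ {a b} (w : Word a) i (Q : NMI b) → basis w ∘ᴺ[ i ] Q ≋ wordComp w i Q
  basis-∘ᴺ w i Q = ≋trans (≡⇒≋ (∘ᴺ-as-lin (basis w) i Q)) (lin-basis (λ u → wordComp u i Q) w)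

  θ∂ⁿ : ∀ n → θ (∂ⁿ n) ≋ basis (n ∷ [])
  θ∂ⁿ zero = ≋refl
  θ∂ⁿ (suc n) = ≋trans (∘ᴺ-resp zero (≋refl {s = X₁}) (θ∂ⁿ n))
    (≋trans (basis-∘ᴺ (1 ∷ []) zero (basis (n ∷ [])))
    (≡⇒≋ (trans (mapWords-cong (splice-unit 1) _) (mapWords-id _))))

  θ-monomial : ∀ {a} (w : Word a) → θ (monomial w) ≋ basis w
  θ-monomial {zero} (n ∷ []) = θ∂ⁿ n
  θ-monomial {suc a} (n ∷ v) =
    ≋trans (∘ᴺ-resp (suc zero) (≋trans (∘ᴺ-resp zero (≋refl {s = X₀X₀}) (θ∂ⁿ n)) (basis-∘ᴺ (0 ∷ 0 ∷ []) zero (basis (n ∷ [])))) (θ-monomial v))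
    (≋trans (∘ᴺ-resp (suc zero) (≡⇒≋ (cong basis w1)) (≋refl {s = basis v}))
    (≋trans (basis-∘ᴺ (n ∷ 0 ∷ []) (suc zero) (basis v))
    (≡⇒≋ (cong basis w2))))
    where
    w1 : splice (0 ∷ 0 ∷ []) zero (n ∷ []) ≡ n ∷ 0 ∷ []
    w1 = toList-injective (toList-splice (0 ∷ 0 ∷ []) zero (n ∷ []))
    w2 : splice (n ∷ 0 ∷ []) (suc zero) v ≡ n ∷ v
    w2 = toList-injective (trans (toList-splice (n ∷ 0 ∷ []) (suc zero) v) (cong (n ∷_) (Listₚ.++-identityʳ (toList v))))

  θ∘ψ : ∀ {a} (P : NMI a) → θ (ψ P) ≋ P
  θ∘ψ [] = ≋refl
  θ∘ψ ((x , w) ∷ P) =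
    ≋trans (++cong (·ᴺ-cong 𝔽.refl (θ-monomial w)) (θ∘ψ P))
    (≋trans (≡⇒≋ (cong (_++ P) (·ᴺ≡·ᶠ x (basis w))))
     (∷-cong w (𝔽.*-identityʳ x) ≋refl))

  θ-isOperadMorphism : IsOperadMorphism θ
  θ-isOperadMorphism = record
    { resp = λ {a} {s} {t} h → ≋⇒≈ᴺ (θ s) (θ t) (θ-resp h)
    ; hom-⊕ = λ s t w → 𝔽.refl
    ; hom-· = λ x s w → 𝔽.refl
    ; hom-unit = λ w → 𝔽.refl
    ; hom-∘ = λ s i t w → 𝔽.refl
    ; hom-act = λ s σ w → 𝔽.refl }

  θ-isOperadIsomorphism : IsOperadIsomorphism θ
  θ-isOperadIsomorphism = record
    { isMorphism = θ-isOperadMorphism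
    ; injective = λ {a} {s} {t} h → ≈-trans (≈-sym (ψ∘θ s)) (≈-trans (linᵀ-resp monomial (≈ᴺ⇒≋ (θ s) (θ t) h)) (ψ∘θ t))
    ; surjective = λ P → ψ P , ≋⇒≈ᴺ (θ (ψ P)) P (θ∘ψ P) }

  θ-sendsGenerators : SendsGenerators θ
  θ-sendsGenerators = (λ w → 𝔽.refl) , (λ w → 𝔽.refl)

  θ-unique : ∀ (θ′ : ∀ {a} → Term a → NMI a) → IsOperadIsomorphism θ′ → SendsGenerators θ′ →
             ∀ {a} (s : Term a) → θ′ s ≈ᴺ θ s
  θ-unique θ′ iso′ (θ′∂ , θ′m) s = ≋⇒≈ᴺ (θ′ s) (θ s) (agree s)
    where
    open IsOperadMorphism (IsOperadIsomorphism.isMorphism iso′)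
    agree : ∀ {a} (s : Term a) → θ′ s ≋ θ s
    agree ∂ⁱ = ≈ᴺ⇒≋ (θ′ ∂ⁱ) X₁ θ′∂
    agree mⁱ = ≈ᴺ⇒≋ (θ′ mⁱ) X₀X₀ θ′m
    agree unit = ≈ᴺ⇒≋ (θ′ unit) Iᴺ hom-unit
    agree (s ∘[ i ] t) =
      ≋trans (≈ᴺ⇒≋ (θ′ (s ∘[ i ] t)) (θ′ s ∘ᴺ[ i ] θ′ t) (hom-∘ s i t)) (∘ᴺ-resp i (agree s) (agree t))
    agree (act s σ) = ≋trans (≈ᴺ⇒≋ (θ′ (act s σ)) (actᴺ (θ′ s) σ) (hom-act s σ)) (actᴺ-resp σ (agree s))
    agree 𝟘 =
      ≋trans (≈ᴺ⇒≋ (θ′ 𝟘) (θ′ (0# · 𝟘)) (resp (≈-sym (·-zero 𝟘))))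
      (≋trans (≈ᴺ⇒≋ (θ′ (0# · 𝟘)) (0# ·ᴺ θ′ 𝟘) (hom-· 0# 𝟘)) (·ᴺ-zero (θ′ 𝟘)))
    agree (s ⊕ t) = ≋trans (≈ᴺ⇒≋ (θ′ (s ⊕ t)) (θ′ s ++ θ′ t) (hom-⊕ s t)) (++cong (agree s) (agree t))
    agree (x · s) = ≋trans (≈ᴺ⇒≋ (θ′ (x · s)) (x ·ᴺ θ′ s) (hom-· x s)) (·ᴺ-cong 𝔽.refl (agree s))

theorem2p8 : ∀ {c ℓ} (F : Field c ℓ) → CharacteristicZero F →
    let open Over F in
    Σ (∀ {a} → Term a → NMI a) λ θ →
    IsOperadIsomorphism θ × SendsGenerators θ ×
    (∀ (θ′ : ∀ {a} → Term a → NMI a) → IsOperadIsomorphism θ′ → SendsGenerators θ′ →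
    ∀ {a} (s : Term a) → θ′ s ≈ᴺ θ s)
theorem2p8 F _ = θ , θ-isOperadIsomorphism , θ-sendsGenerators , θ-unique
  where
  open Interpretation F using (θ)
  open Isomorphism F
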